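{- Let $n\ge 2$ and $1\le k\le n-1$. For each $i\in[n]$, the number of permutations in the set $\{{d^\ast}^k_n\}$ whose first entry is $i$ is the same for all $i$, and equals $d^{k-1}_{n-1}$.
   Context: Permutations of $[n]=\{1,\dots,n\}$ are written in one-line notation $p=p(1)\cdots p(n)$. $\{{d^\ast}^k_n\}$ is the set of permutations $p$ of $[n]$ such that there is no $i\in\{1,\dots,n-1\}$ with $p(i+1)=p(i)+k$, and $p(1)\ne p(n)+k$. For $N\ge1$ and $1\le m\le N-1$, $d^m_N$ is the number of permutations $p$ of $[N]$ with no $i\in\{1,\dots,N-1\}$ such that $p(i+1)=p(i)+m$ (equivalently $d^m_N=\sum_{j=0}^{N-m}(-1)^j\binom{N-m}{j}(N-j)!$), and $d^0_N$ is the derangement number $\mathrm{Der}(N)=\sum_{j=0}^{N}(-1)^j\binom{N}{j}(N-j)!$. -}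

module Defs where

open import Data.Nat using (ℕ; zero; suc; _+_; _∸_; _≟_)
open import Data.Fin using (Fin; toℕ)
open import Data.Fin.Properties using (all?)
open import Data.Vec using (Vec; []; _∷_; lookup)
open import Data.List using (List; [_]; map; concatMap; filter; length; allFin)
open import Relation.Nullary using (¬_; Dec; ¬?; _→-dec_)
open import Relation.Nullary.Decidable using (_×-dec_)
open import Relation.Binary.PropositionalEquality using (_≡_; _≢_)
open import Data.Product using (_×_)

allVecs : ∀ {A : Set} → List A → (m : ℕ) → List (Vec A m)
allVecs xs zero    = [ [] ]
allVecs xs (suc m) = concatMap (λ x → map (x ∷_) (allVecs xs m)) xs

-- a permutation of [n] in one-line notation: the vector p(1)…p(n),
-- entries in Fin n (value a ↔ a+1), required to be injective
IsPerm : ∀ {n} → Vec (Fin n) n → Set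
IsPerm {n} p = ∀ (i j : Fin n) → lookup p i ≡ lookup p j → i ≡ j

isPerm? : ∀ {n} (p : Vec (Fin n) n) → Dec (IsPerm p)
isPerm? p = all? λ i → all? λ j → (Data.Fin._≟_ (lookup p i) (lookup p j)) →-dec (Data.Fin._≟_ i j)

perms : (n : ℕ) → List (Vec (Fin n) n)
perms n = filter isPerm? (allVecs (allFin n) n)

-- values (shifting by one does not affect differences)
val : ∀ {n} → Vec (Fin n) n → Fin n → ℕ
val p i = toℕ (lookup p i)

NoSucc : ℕ → ∀ {n} → Vec (Fin n) n → Set
NoSucc m {n} p = ∀ (i j : Fin n) → toℕ j ≡ suc (toℕ i) → val p j ≢ val p i + m

noSucc? : (m : ℕ) → ∀ {n} (p : Vec (Fin n) n) → Dec (NoSucc m p)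
noSucc? m p = all? λ i → all? λ j → (toℕ j ≟ suc (toℕ i)) →-dec ¬? (val p j ≟ val p i + m)

NoCyc : ℕ → ∀ {n} → Vec (Fin n) n → Set
NoCyc k {n} p = ∀ (i j : Fin n) → toℕ i ≡ 0 → toℕ j ≡ n ∸ 1 → val p i ≢ val p j + k

noCyc? : (k : ℕ) → ∀ {n} (p : Vec (Fin n) n) → Dec (NoCyc k p)
noCyc? k {n} p = all? λ i → all? λ j →
  (toℕ i ≟ 0) →-dec ((toℕ j ≟ n ∸ 1) →-dec ¬? (val p i ≟ val p j + k))

Derangement : ∀ {n} → Vec (Fin n) n → Set
Derangement {n} p = ∀ (i : Fin n) → lookup p i ≢ i

derangement? : ∀ {n} (p : Vec (Fin n) n) → Dec (Derangement p)
derangement? p = all? λ i → ¬? (Data.Fin._≟_ (lookup p i) i)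

dstar : (k n : ℕ) → List (Vec (Fin n) n)
dstar k n = filter (λ p → noSucc? k p ×-dec noCyc? k p) (perms n)

d : (m N : ℕ) → ℕ
d zero    N = length (filter derangement? (perms N))
d (suc m) N = length (filter (noSucc? (suc m)) (perms N))

countFirst : (k n : ℕ) → Fin n → ℕ
countFirst k (suc n) i = length (filter (λ p → Data.Fin._≟_ (lookup p Data.Fin.zero) i) (dstar k (suc n)))

module Submission where

-- Fix the first entry i of p.  Then p = i l for an arrangement l of [n] ∖ {i}, and p lies in
-- d*ᵏₙ exactly when the cyclic word i l i contains none of the n − k adjacencies x → x + k.
-- These forbidden adjacencies form disjoint increasing paths (the letter i may be an
-- endpoint), and for any such system of e adjacencies on N letters inclusion–exclusion
-- gives Σⱼ (−1)ʲ C(e,j) (N−j)! arrangements: forcing one adjacency merges its two letters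
-- into one and leaves a system of the same kind.  Here N = n − 1 and e = n − k for every i.
-- For k ≥ 2 the successions x → x + k − 1 of [n − 1] form such a system with the same N and
-- e, and for k = 1 the n − 1 forbidden fixed points obey the same recursion (rook boards).

open import Data.Bool using (Bool; true; false; not; _∧_; _∨_; T?; if_then_else_)
open import Data.Bool.Properties
  using (T-≡; ∨-zeroʳ; ∧-assoc; ∧-comm; ∧-zeroʳ; ∧-identityʳ; not-involutive)
open import Data.Fin using (Fin; zero; suc; toℕ; fromℕ)
import Data.Fin as Fin
open import Data.Fin.Properties using (toℕ-injective; toℕ-fromℕ; toℕ<n)
import Data.Fin.Properties as Finₚ
open import Data.List
  using (List; []; _∷_; [_]; _++_; length; map; concatMap; filter; filterᵇ; take; drop;
         catMaybes; tabulate; allFin; applyUpTo; upTo)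
open import Data.List.Properties
  using (map-id; map-∘; map-++; length-map; length-upTo; length-++; length-++-sucʳ; length-take;
         take++drop≡id; ++-assoc; ++-identityʳ; catMaybes-++; filter-accept; filter-reject; filter-all)
open import Data.List.Membership.Propositional using (_∈_; _∉_; find)
open import Data.List.Membership.Propositional.Properties
  using (∈-upTo⁺; ∈-upTo⁻; ∈-∃++; ∈-insert; ∈-++⁻; ∈-++⁺ˡ; ∈-++⁺ʳ; ∈-map⁺; ∈-map⁻;
         ∈-concatMap⁺; ∈-concatMap⁻; ∈-filter⁺; ∈-filter⁻)
open import Data.List.Relation.Binary.Subset.Propositional using (_⊆_)
open import Data.List.Relation.Unary.All as All using (All; []; _∷_)
open import Data.List.Relation.Unary.All.Properties as All using (All¬⇒¬Any; ¬Any⇒All¬)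
import Data.List.Relation.Unary.AllPairs as AllPairs
open import Data.List.Relation.Unary.Any as Any using (here; there)
open import Data.List.Relation.Unary.Unique.Propositional using (Unique; []; _∷_)
import Data.List.Relation.Unary.Unique.Propositional.Properties as Unique
open import Data.List.Relation.Unary.Unique.Propositional.Properties using (Unique[x∷xs]⇒x∉xs; upTo⁺)
open import Data.Maybe using (Maybe; just; nothing)
open import Data.Nat using (ℕ; zero; suc; _+_; _*_; _∸_; _≤_; _<_; z≤n; s≤s; _!)
import Data.Nat as ℕ
open import Data.Nat.Properties
  using (suc-injective; +-suc; +-assoc; +-comm; +-identityʳ; +-cancelʳ-≡; m+n∸n≡m; m≤m+n;
         m<m+n; m+n≤o⇒m≤o∸n; m≤n⇒m⊓n≡m; ≤-antisym; ≤-<-trans; <-trans; <-irrefl; 1+n≰n)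
open import Data.Product using (_×_; _,_; proj₁; proj₂; ∃; ∃₂; map₁)
open import Data.Sum using (_⊎_; inj₁; inj₂; [_,_]′)
open import Data.Vec using (Vec; []; _∷_; lookup)
import Data.Vec as Vec
open import Function using (_∘_; const; id)
open import Function.Bundles using (Equivalence)
open import Relation.Binary.Definitions using (DecidableEquality)
open import Relation.Binary.PropositionalEquality
  using (_≡_; _≢_; refl; sym; trans; cong; cong₂; subst; subst₂; module ≡-Reasoning)
open import Relation.Nullary using (¬_; Dec; yes; no; does; ¬?; contradiction)
open import Relation.Nullary.Decidable using (dec-true; dec-false; _×-dec_)
open import Relation.Unary using (Decidable)

open import Defs

module _ {A : Set} {x : A} where

  ∈-middle⁺ : ∀ {y} L₁ {L₂} → y ∈ L₁ ++ L₂ → y ∈ L₁ ++ x ∷ L₂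
  ∈-middle⁺ L₁ y∈ with ∈-++⁻ L₁ y∈
  ... | inj₁ y∈L₁ = ∈-++⁺ˡ y∈L₁
  ... | inj₂ y∈L₂ = ∈-++⁺ʳ L₁ (there y∈L₂)

  ∈-middle⁻ : ∀ {y} L₁ {L₂} → y ∈ L₁ ++ x ∷ L₂ → y ≡ x ⊎ y ∈ L₁ ++ L₂
  ∈-middle⁻ L₁ y∈ with ∈-++⁻ L₁ y∈
  ... | inj₁ y∈L₁         = inj₂ (∈-++⁺ˡ y∈L₁)
  ... | inj₂ (here y≡x)   = inj₁ y≡x
  ... | inj₂ (there y∈L₂) = inj₂ (∈-++⁺ʳ L₁ y∈L₂)

  All-middle⁻ : ∀ {P : A → Set} L₁ {L₂} → All P (L₁ ++ x ∷ L₂) → P x × All P (L₁ ++ L₂)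
  All-middle⁻ L₁ all with All.++⁻ L₁ all
  ... | all₁ , px ∷ all₂ = px , All.++⁺ all₁ all₂

  All-middle⁺ : ∀ {P : A → Set} L₁ {L₂} → P x → All P (L₁ ++ L₂) → All P (L₁ ++ x ∷ L₂)
  All-middle⁺ L₁ px all with All.++⁻ L₁ all
  ... | all₁ , all₂ = All.++⁺ all₁ (px ∷ all₂)

  Unique-middle⁻ : ∀ L₁ {L₂} → Unique (L₁ ++ x ∷ L₂) → x ∉ L₁ ++ L₂ × Unique (L₁ ++ L₂)
  Unique-middle⁻ []       (x∉ ∷ u) = All¬⇒¬Any x∉ , u
  Unique-middle⁻ (y ∷ L₁) (y∉ ∷ u) =
    let x∉ , u′ = Unique-middle⁻ L₁ u ; y≢x , y∉′ = All-middle⁻ L₁ y∉ in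
    (λ { (here x≡y) → y≢x (sym x≡y) ; (there x∈) → x∉ x∈ }) , y∉′ ∷ u′

  Unique-middle⁺ : ∀ L₁ {L₂} → x ∉ L₁ ++ L₂ → Unique (L₁ ++ L₂) → Unique (L₁ ++ x ∷ L₂)
  Unique-middle⁺ []       x∉ u        = ¬Any⇒All¬ _ x∉ ∷ u
  Unique-middle⁺ (y ∷ L₁) x∉ (y∉ ∷ u) =
    All-middle⁺ L₁ (λ y≡x → x∉ (here (sym y≡x))) y∉ ∷ Unique-middle⁺ L₁ (x∉ ∘ there) u

module _ {A : Set} where

  ∉⇒All≢ : {x : A} {L : List A} → x ∉ L → All (_≢ x) L
  ∉⇒All≢ {L = L} x∉ = All.map (_∘ sym) (¬Any⇒All¬ L x∉)

  ∉⇒∷-unique : {x : A} {S L : List A} → x ∉ S → L ⊆ S → Unique L → Unique (x ∷ L)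
  ∉⇒∷-unique {L = L} x∉S L⊆S u = ¬Any⇒All¬ L (x∉S ∘ L⊆S) ∷ u

countᵇ : {A : Set} → (A → Bool) → List A → ℕ
countᵇ p xs = length (filterᵇ p xs)

module _ {A : Set} where

  countᵇ-cong : {p q : A → Bool} (xs : List A) → (∀ {x} → x ∈ xs → p x ≡ q x) →
                countᵇ p xs ≡ countᵇ q xs
  countᵇ-cong []       _   = refl
  countᵇ-cong {p} {q} (x ∷ xs) p≗q with p x | q x | p≗q (here refl)
  ... | true  | true  | _ = cong suc (countᵇ-cong xs (p≗q ∘ there))
  ... | false | false | _ = countᵇ-cong xs (p≗q ∘ there)

  countᵇ-split : (p q : A → Bool) (xs : List A) →
                 countᵇ p xs ≡ countᵇ (λ x → p x ∧ q x) xs + countᵇ (λ x → p x ∧ not (q x)) xs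
  countᵇ-split p q [] = refl
  countᵇ-split p q (x ∷ xs) with p x | q x
  ... | true  | true  = cong suc (countᵇ-split p q xs)
  ... | true  | false = trans (cong suc (countᵇ-split p q xs)) (sym (+-suc _ _))
  ... | false | _     = countᵇ-split p q xs

  countᵇ-none : (p : A → Bool) (xs : List A) → (∀ {x} → x ∈ xs → p x ≡ false) → countᵇ p xs ≡ 0
  countᵇ-none p [] _ = refl
  countᵇ-none p (x ∷ xs) p≡false with p x | p≡false (here refl)
  ... | false | _ = countᵇ-none p xs (p≡false ∘ there)

  length-filter≡countᵇ : {P : A → Set} (P? : Decidable P) (xs : List A) →
                         length (filter P? xs) ≡ countᵇ (does ∘ P?) xs
  length-filter≡countᵇ P? [] = refl
  length-filter≡countᵇ P? (x ∷ xs) with does (P? x)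
  ... | true  = cong suc (length-filter≡countᵇ P? xs)
  ... | false = length-filter≡countᵇ P? xs

  countᵇ-filter : {P : A → Set} (P? : Decidable P) (p : A → Bool) (xs : List A) →
                  countᵇ p (filter P? xs) ≡ countᵇ (λ x → does (P? x) ∧ p x) xs
  countᵇ-filter P? p [] = refl
  countᵇ-filter P? p (x ∷ xs) with does (P? x)
  ... | false = countᵇ-filter P? p xs
  ... | true with p x
  ...   | true  = cong suc (countᵇ-filter P? p xs)
  ...   | false = countᵇ-filter P? p xs

countᵇ-map : {A B : Set} (p : B → Bool) (f : A → B) (xs : List A) → countᵇ p (map f xs) ≡ countᵇ (p ∘ f) xs
countᵇ-map p f [] = refl
countᵇ-map p f (x ∷ xs) with p (f x)
... | true  = cong suc (countᵇ-map p f xs)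
... | false = countᵇ-map p f xs

length-≤-retract : {A B : Set} {xs : List A} {ys : List B} (f : A → B) (g : B → A) → Unique xs →
                   (∀ {x} → x ∈ xs → f x ∈ ys) → (∀ {x} → x ∈ xs → g (f x) ≡ x) →
                   length xs ≤ length ys
length-≤-retract {xs = []}     f g _          _    _  = z≤n
length-≤-retract {xs = x ∷ xs} f g (x∉xs ∷ u) into gf with ∈-∃++ (into (here refl))
... | ys₁ , ys₂ , refl = subst (suc (length xs) ≤_) (sym (length-++-sucʳ ys₁ (f x) ys₂))
                           (s≤s (length-≤-retract f g u into′ (gf ∘ there)))
  where
  into′ : ∀ {y} → y ∈ xs → f y ∈ ys₁ ++ ys₂
  into′ {y} y∈xs with ∈-middle⁻ ys₁ (into (there y∈xs))
  ... | inj₂ fy∈ = fy∈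
  ... | inj₁ fy≡fx = contradiction
    (trans (sym (gf (here refl))) (trans (cong g (sym fy≡fx)) (gf (there y∈xs))))
    (All.lookup x∉xs y∈xs)

countᵇ-≤ : {A B : Set} {xs : List A} {ys : List B} (p : A → Bool) (q : B → Bool) (f : A → B) (g : B → A) →
           Unique xs → (∀ {x} → x ∈ xs → p x ≡ true → f x ∈ ys × q (f x) ≡ true × g (f x) ≡ x) →
           countᵇ p xs ≤ countᵇ q ys
countᵇ-≤ {xs = xs} {ys} p q f g u fwd = length-≤-retract f g (Unique.filter⁺ (T? ∘ p) u) into retract
  where
  unfilter : ∀ {x} → x ∈ filterᵇ p xs → x ∈ xs × p x ≡ true
  unfilter x∈ = let x∈xs , px = ∈-filter⁻ (T? ∘ p) {xs = xs} x∈ in x∈xs , Equivalence.to T-≡ px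
  into : ∀ {x} → x ∈ filterᵇ p xs → f x ∈ filterᵇ q ys
  into x∈ = let x∈xs , px = unfilter x∈ ; fx∈ys , qfx , _ = fwd x∈xs px in
            ∈-filter⁺ (T? ∘ q) fx∈ys (Equivalence.from T-≡ qfx)
  retract : ∀ {x} → x ∈ filterᵇ p xs → g (f x) ≡ x
  retract x∈ = let x∈xs , px = unfilter x∈ in proj₂ (proj₂ (fwd x∈xs px))

countᵇ-bijection : {A B : Set} {xs : List A} {ys : List B} (p : A → Bool) (q : B → Bool)
  (f : A → B) (g : B → A) → Unique xs → Unique ys →
  (∀ {x} → x ∈ xs → p x ≡ true → f x ∈ ys × q (f x) ≡ true × g (f x) ≡ x) →
  (∀ {y} → y ∈ ys → q y ≡ true → g y ∈ xs × p (g y) ≡ true × f (g y) ≡ y) →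
  countᵇ p xs ≡ countᵇ q ys
countᵇ-bijection p q f g uxs uys fwd bwd = ≤-antisym (countᵇ-≤ p q f g uxs fwd) (countᵇ-≤ q p g f uys bwd)

-- Words without forbidden adjacencies

module _ {A : Set} where

  avoids : (A → A → Bool) → List A → Bool
  avoids R (x ∷ y ∷ w) = not (R x y) ∧ avoids R (y ∷ w)
  avoids R _           = true

  -- The cyclic word ∗ l ∗: its adjacencies are those of l read cyclically after the letter ∗.
  ring : A → List A → List A
  ring ∗ l = ∗ ∷ l ++ [ ∗ ]

  lastOr : A → List A → A
  lastOr x []      = x
  lastOr x (y ∷ w) = lastOr y w

  avoids-never : ∀ w → avoids (λ _ _ → false) w ≡ true
  avoids-never []          = refl
  avoids-never (x ∷ [])    = refl
  avoids-never (x ∷ y ∷ w) = avoids-never (y ∷ w)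

  avoids-∨ : ∀ R R′ w → avoids (λ x y → R x y ∨ R′ x y) w ≡ avoids R w ∧ avoids R′ w
  avoids-∨ R R′ []          = refl
  avoids-∨ R R′ (x ∷ [])    = refl
  avoids-∨ R R′ (x ∷ y ∷ w) =
    trans (cong (not (R x y ∨ R′ x y) ∧_) (avoids-∨ R R′ (y ∷ w))) (not-∨-∧ (R x y) (R′ x y) _ _)
    where
    not-∨-∧ : ∀ a b c d → not (a ∨ b) ∧ (c ∧ d) ≡ (not a ∧ c) ∧ (not b ∧ d)
    not-∨-∧ true  _     _ _ = refl
    not-∨-∧ false true  c _ = sym (∧-zeroʳ c)
    not-∨-∧ false false _ _ = refl

  avoids-++ : ∀ R P {x w} → avoids R (P ++ x ∷ w) ≡ avoids R (P ++ [ x ]) ∧ avoids R (x ∷ w)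
  avoids-++ R []                  = refl
  avoids-++ R (p ∷ [])    {x} {w} = cong (_∧ avoids R (x ∷ w)) (sym (∧-identityʳ (not (R p x))))
  avoids-++ R (p ∷ q ∷ P) {x} {w} =
    trans (cong (not (R p q) ∧_) (avoids-++ R (q ∷ P)))
          (sym (∧-assoc (not (R p q)) (avoids R (q ∷ P ++ [ x ])) (avoids R (x ∷ w))))

  avoids-∷ʳ : ∀ R x w {z} → avoids R (x ∷ w ++ [ z ]) ≡ avoids R (x ∷ w) ∧ not (R (lastOr x w) z)
  avoids-∷ʳ R x []      {z} = ∧-identityʳ (not (R x z))
  avoids-∷ʳ R x (y ∷ w) {z} =
    trans (cong (not (R x y) ∧_) (avoids-∷ʳ R y w)) (sym (∧-assoc (not (R x y)) (avoids R (y ∷ w)) _))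

  avoids-ring : ∀ R z w → (∀ y → R z y ≡ false) → (∀ x → R x z ≡ false) → avoids R (ring z w) ≡ avoids R w
  avoids-ring R z []      from to = cong (λ c → not c ∧ true) (from z)
  avoids-ring R z (x ∷ w) from to = begin
    not (R z x) ∧ avoids R (x ∷ w ++ [ z ])    ≡⟨ cong (λ c → not c ∧ avoids R (x ∷ w ++ [ z ])) (from x) ⟩
    avoids R (x ∷ w ++ [ z ])                  ≡⟨ avoids-∷ʳ R x w ⟩
    avoids R (x ∷ w) ∧ not (R (lastOr x w) z)  ≡⟨ cong (λ c → avoids R (x ∷ w) ∧ not c) (to (lastOr x w)) ⟩
    avoids R (x ∷ w) ∧ true                    ≡⟨ ∧-identityʳ _ ⟩
    avoids R (x ∷ w)                           ∎
    where open ≡-Reasoning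

  avoids-cong-∈ : ∀ {R R′ : A → A → Bool} w → (∀ {x y} → x ∈ w → y ∈ w → R x y ≡ R′ x y) →
                  avoids R w ≡ avoids R′ w
  avoids-cong-∈ []          _     = refl
  avoids-cong-∈ (x ∷ [])    _     = refl
  avoids-cong-∈ (x ∷ y ∷ w) agree = cong₂ (λ c d → not c ∧ d) (agree (here refl) (there (here refl)))
    (avoids-cong-∈ (y ∷ w) λ x∈ y∈ → agree (there x∈) (there y∈))

  -- The last letter of w ++ [ z ] starts no adjacency, so R and R′ need only agree on the others.
  avoids-cong-init : ∀ {R R′ : A → A → Bool} w z → All (λ x → ∀ y → R x y ≡ R′ x y) w →
                     avoids R (w ++ [ z ]) ≡ avoids R′ (w ++ [ z ])
  avoids-cong-init []          z []            = refl
  avoids-cong-init (x ∷ [])    z (same ∷ [])   = cong (λ c → not c ∧ true) (same z)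
  avoids-cong-init (x ∷ y ∷ w) z (same ∷ rest) =
    cong₂ (λ c d → not c ∧ d) (same y) (avoids-cong-init (y ∷ w) z rest)

  -- Merging the adjacent letters a b into a, which takes over the adjacencies starting at b.
  avoids-contract : ∀ {R R′ : A → A → Bool} {a b} P L z →
    R a b ≡ false → (∀ y → R′ a y ≡ R b y) → (∀ {x} y → x ≢ a → x ≢ b → R x y ≡ R′ x y) →
    All (λ x → x ≢ a × x ≢ b) (P ++ L) →
    avoids R (P ++ a ∷ b ∷ L ++ [ z ]) ≡ avoids R′ (P ++ a ∷ L ++ [ z ])
  avoids-contract {R} {R′} {a} {b} P L z a↛b inherit other away = begin
    avoids R (P ++ a ∷ b ∷ L ++ [ z ])
      ≡⟨ avoids-++ R P ⟩
    avoids R (P ++ [ a ]) ∧ avoids R (a ∷ b ∷ L ++ [ z ])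
      ≡⟨ cong₂ _∧_ (avoids-cong-init P a (same awayP)) (cong (λ c → not c ∧ avoids R (b ∷ L ++ [ z ])) a↛b) ⟩
    avoids R′ (P ++ [ a ]) ∧ avoids R (b ∷ L ++ [ z ])
      ≡⟨ cong (avoids R′ (P ++ [ a ]) ∧_) (first L awayL) ⟩
    avoids R′ (P ++ [ a ]) ∧ avoids R′ (a ∷ L ++ [ z ])
      ≡⟨ sym (avoids-++ R′ P) ⟩
    avoids R′ (P ++ a ∷ L ++ [ z ]) ∎
    where
    open ≡-Reasoning
    awayP : All (λ x → x ≢ a × x ≢ b) P
    awayP = proj₁ (All.++⁻ P away)
    awayL : All (λ x → x ≢ a × x ≢ b) L
    awayL = proj₂ (All.++⁻ P away)
    same : ∀ {w} → All (λ x → x ≢ a × x ≢ b) w → All (λ x → ∀ y → R x y ≡ R′ x y) w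
    same = All.map λ (x≢a , x≢b) y → other y x≢a x≢b
    first : ∀ L → All (λ x → x ≢ a × x ≢ b) L → avoids R (b ∷ L ++ [ z ]) ≡ avoids R′ (a ∷ L ++ [ z ])
    first []      _     = cong (λ c → not c ∧ true) (sym (inherit z))
    first (y ∷ L) away′ =
      cong₂ (λ c d → not c ∧ d) (sym (inherit y)) (avoids-cong-init (y ∷ L) z (same away′))

-- Inclusion–exclusion numbers avoiders N e = Σⱼ (−1)ʲ C(e,j) (N−j)!, given by the
-- deletion–contraction recurrence; the subtraction never truncates where the recurrence is used.

avoiders : ℕ → ℕ → ℕ
avoiders n       zero    = n !
avoiders zero    (suc e) = 0
avoiders (suc n) (suc e) = avoiders (suc n) e ∸ avoiders n e

-- Counting arrangements

module Arrangements {A : Set} (_≟_ : DecidableEquality A) where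

  open import Data.List.Relation.Unary.Unique.DecPropositional _≟_ using (unique?)
  open import Data.List.Membership.DecPropositional _≟_ using (_∈?_)

  words : List A → ℕ → List (List A)
  words S zero    = [ [] ]
  words S (suc m) = concatMap (λ x → map (x ∷_) (words S m)) S

  ∈-words⁺ : ∀ {S} l → l ⊆ S → l ∈ words S (length l)
  ∈-words⁺ []      _   = here refl
  ∈-words⁺ (x ∷ l) l⊆S = ∈-concatMap⁺ _
    (Any.map (λ { refl → ∈-map⁺ (x ∷_) (∈-words⁺ l (l⊆S ∘ there)) }) (l⊆S (here refl)))

  ∈-words⁻ : ∀ {S} m {l} → l ∈ words S m → length l ≡ m × l ⊆ S
  ∈-words⁻ zero (here refl) = refl , λ ()
  ∈-words⁻ {S} (suc m) l∈ with find (∈-concatMap⁻ _ {xs = S} l∈)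
  ... | x , x∈S , l∈x∷W with ∈-map⁻ (x ∷_) l∈x∷W
  ... | l′ , l′∈W , refl with ∈-words⁻ m l′∈W
  ... | refl , l′⊆S = refl , λ { (here refl) → x∈S ; (there y∈l′) → l′⊆S y∈l′ }

  words-unique : ∀ {S} m → Unique S → Unique (words S m)
  words-unique zero    _  = [] ∷ []
  words-unique {S} (suc m) uS = prepend-unique S uS
    where
    W : List (List A)
    W = words S m
    head≡ : ∀ {x l} → l ∈ map (x ∷_) W → ∃ λ l′ → l ≡ x ∷ l′
    head≡ l∈ = let l′ , _ , eq = ∈-map⁻ _ l∈ in l′ , eq
    prepend-unique : ∀ T → Unique T → Unique (concatMap (λ x → map (x ∷_) W) T)
    prepend-unique []      _            = []
    prepend-unique (x ∷ T) (x∉T ∷ uT) =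
      Unique.++⁺ (Unique.map⁺ (λ { refl → refl }) (words-unique m uS)) (prepend-unique T uT) disjoint
      where
      disjoint : ∀ {l} → ¬ (l ∈ map (x ∷_) W × l ∈ concatMap (λ x → map (x ∷_) W) T)
      disjoint (l∈x , l∈T) with find (∈-concatMap⁻ _ {xs = T} l∈T)
      ... | y , y∈T , l∈y with head≡ l∈x | head≡ l∈y
      ... | _ , refl | _ , refl = All.lookup x∉T y∈T refl

  record IsArrangement (S l : List A) : Set where
    constructor arrangement
    field
      length≡ : length l ≡ length S
      ⊆S      : l ⊆ S
      unique  : Unique l

  #arrangements : List A → (List A → Bool) → ℕ
  #arrangements S p = countᵇ (λ l → does (unique? l) ∧ p l) (words S (length S))

  module _ {S : List A} {p : List A → Bool} where

    arrangement⁻ : ∀ {l} → l ∈ words S (length S) → (does (unique? l) ∧ p l) ≡ true →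
                   IsArrangement S l × p l ≡ true
    arrangement⁻ {l} l∈ ok with unique? l
    ... | yes u = let len , sub = ∈-words⁻ _ l∈ in arrangement len sub u , ok

    arrangement⁺ : ∀ {l} → IsArrangement S l → p l ≡ true →
                   l ∈ words S (length S) × (does (unique? l) ∧ p l) ≡ true
    arrangement⁺ {l} (arrangement len sub u) pl =
      subst (λ m → l ∈ words S m) len (∈-words⁺ l sub) , cong₂ _∧_ (dec-true (unique? l) u) pl

  #arrangements-cong : ∀ S {p q} → (∀ {l} → IsArrangement S l → p l ≡ q l) →
                       #arrangements S p ≡ #arrangements S q
  #arrangements-cong S {p} {q} p≗q = countᵇ-cong (words S (length S)) agree
    where
    agree : ∀ {l} → l ∈ words S (length S) → (does (unique? l) ∧ p l) ≡ (does (unique? l) ∧ q l)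
    agree {l} l∈ with unique? l
    ... | yes u = let len , sub = ∈-words⁻ _ l∈ in p≗q (arrangement len sub u)
    ... | no _  = refl

  #arrangements-split : ∀ S p q → #arrangements S p ≡
    #arrangements S (λ l → p l ∧ q l) + #arrangements S (λ l → p l ∧ not (q l))
  #arrangements-split S p q = trans (countᵇ-split (λ l → does (unique? l) ∧ p l) q (words S (length S)))
    (cong₂ _+_ (countᵇ-cong (words S (length S)) (λ {l} _ → ∧-assoc (does (unique? l)) (p l) (q l)))
               (countᵇ-cong (words S (length S)) (λ {l} _ → ∧-assoc (does (unique? l)) (p l) (not (q l)))))

  #arrangements-none : ∀ S p → (∀ {l} → IsArrangement S l → p l ≡ false) → #arrangements S p ≡ 0
  #arrangements-none S p none = trans (#arrangements-cong S none)
    (countᵇ-none (λ l → does (unique? l) ∧ false) (words S (length S)) (λ {l} _ → ∧-zeroʳ (does (unique? l))))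

  #arrangements-bijection : ∀ {S T} (p q : List A → Bool) (f g : List A → List A) →
    Unique S → Unique T →
    (∀ {l} → IsArrangement S l → p l ≡ true → IsArrangement T (f l) × q (f l) ≡ true × g (f l) ≡ l) →
    (∀ {l} → IsArrangement T l → q l ≡ true → IsArrangement S (g l) × p (g l) ≡ true × f (g l) ≡ l) →
    #arrangements S p ≡ #arrangements T q
  #arrangements-bijection {S} {T} p q f g uS uT fwd bwd =
    countᵇ-bijection {xs = words S (length S)} {ys = words T (length T)}
      (λ l → does (unique? l) ∧ p l) (λ l → does (unique? l) ∧ q l) f g
      (words-unique (length S) uS) (words-unique (length T) uT)
      (lift {S} {T} {p} {q} {f} {g} fwd) (lift {T} {S} {q} {p} {g} {f} bwd)
    where
    lift : ∀ {S T p q} {f g : List A → List A} →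
      (∀ {l} → IsArrangement S l → p l ≡ true → IsArrangement T (f l) × q (f l) ≡ true × g (f l) ≡ l) →
      ∀ {l} → l ∈ words S (length S) → (does (unique? l) ∧ p l) ≡ true →
      f l ∈ words T (length T) × (does (unique? (f l)) ∧ q (f l)) ≡ true × g (f l) ≡ l
    lift {p = p} {q} to l∈ ok =
      let arr , pl = arrangement⁻ {p = p} l∈ ok ; arr′ , qfl , gfl = to arr pl
          fl∈ , ok′ = arrangement⁺ {p = q} arr′ qfl
      in fl∈ , ok′ , gfl

  infixl 5 _─_
  _─_ : List A → A → List A
  S ─ x = filter (λ y → ¬? (y ≟ x)) S

  ∈-─⁺ : ∀ {S x y} → y ∈ S → y ≢ x → y ∈ S ─ x
  ∈-─⁺ {x = x} = ∈-filter⁺ (λ y → ¬? (y ≟ x))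

  ∈-─⁻ : ∀ {S x y} → y ∈ S ─ x → y ∈ S × y ≢ x
  ∈-─⁻ {S} {x} = ∈-filter⁻ (λ y → ¬? (y ≟ x)) {xs = S}

  ─-unique : ∀ {S} x → Unique S → Unique (S ─ x)
  ─-unique x = Unique.filter⁺ (λ y → ¬? (y ≟ x))

  ─-middle : ∀ {x} L₁ {L₂} → x ∉ L₁ ++ L₂ → (L₁ ++ x ∷ L₂) ─ x ≡ L₁ ++ L₂
  ─-middle {x} []       x∉ = trans (filter-reject (λ y → ¬? (y ≟ x)) (λ x≢x → x≢x refl))
                                   (filter-all (λ y → ¬? (y ≟ x)) (∉⇒All≢ x∉))
  ─-middle {x} (y ∷ L₁) x∉ = trans (filter-accept (λ y → ¬? (y ≟ x)) (λ y≡x → x∉ (here (sym y≡x))))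
                                   (cong (y ∷_) (─-middle L₁ (x∉ ∘ there)))

  length-─ : ∀ {S x} → Unique S → x ∈ S → suc (length (S ─ x)) ≡ length S
  length-─ {S = y ∷ S} (y∉S ∷ _) (here refl) = cong (suc ∘ length) (─-middle [] (All¬⇒¬Any y∉S))
  length-─ {S = y ∷ S} {x} (y∉S ∷ uS) (there x∈S) =
    trans (cong (suc ∘ length) (filter-accept (λ z → ¬? (z ≟ x)) (All.lookup y∉S x∈S)))
          (cong suc (length-─ uS x∈S))

  arrangement-remove : ∀ {S x} L₁ {L₂} → Unique S →
                       IsArrangement S (L₁ ++ x ∷ L₂) → IsArrangement (S ─ x) (L₁ ++ L₂)
  arrangement-remove {x = x} L₁ uS (arrangement len sub u) =
    let x∉ , u′ = Unique-middle⁻ L₁ u in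
    arrangement
      (suc-injective (trans (sym (length-++-sucʳ L₁ x _)) (trans len (sym (length-─ uS (sub (∈-insert L₁)))))))
      (λ y∈ → ∈-─⁺ (sub (∈-middle⁺ L₁ y∈)) (λ { refl → x∉ y∈ }))
      u′

  arrangement-insert : ∀ {S x} L₁ {L₂} → Unique S → x ∈ S →
                       IsArrangement (S ─ x) (L₁ ++ L₂) → IsArrangement S (L₁ ++ x ∷ L₂)
  arrangement-insert {S} {x} L₁ uS x∈S (arrangement len sub u) =
    arrangement
      (trans (length-++-sucʳ L₁ x _) (trans (cong suc len) (length-─ uS x∈S)))
      (λ y∈ → [ (λ { refl → x∈S }) , proj₁ ∘ ∈-─⁻ {S} ∘ sub ]′ (∈-middle⁻ L₁ y∈))
      (Unique-middle⁺ L₁ (λ x∈ → proj₂ (∈-─⁻ {S} (sub x∈)) refl) u)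

  #arrangements-remove : ∀ {S x} (p q : List A → Bool) (insert : List A → List A) → Unique S → x ∈ S →
    (∀ {l} → IsArrangement S l → p l ≡ true →
       ∃₂ λ L₁ L₂ → l ≡ L₁ ++ x ∷ L₂ × insert (L₁ ++ L₂) ≡ l × q (L₁ ++ L₂) ≡ true) →
    (∀ {l} → IsArrangement (S ─ x) l → q l ≡ true →
       ∃₂ λ L₁ L₂ → l ≡ L₁ ++ L₂ × insert l ≡ L₁ ++ x ∷ L₂ × p (insert l) ≡ true) →
    #arrangements S p ≡ #arrangements (S ─ x) q
  #arrangements-remove {S} {x} p q insert uS x∈S split join =
    #arrangements-bijection p q (_─ x) insert uS (─-unique x uS) fwd bwd
    where
    fwd : ∀ {l} → IsArrangement S l → p l ≡ true →
          IsArrangement (S ─ x) (l ─ x) × q (l ─ x) ≡ true × insert (l ─ x) ≡ l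
    fwd arr pl with split arr pl
    ... | L₁ , L₂ , refl , ins , ql =
      subst (λ l′ → IsArrangement (S ─ x) l′ × q l′ ≡ true × insert l′ ≡ L₁ ++ x ∷ L₂)
            (sym (─-middle L₁ (proj₁ (Unique-middle⁻ L₁ (IsArrangement.unique arr)))))
            (arrangement-remove L₁ uS arr , ql , ins)
    bwd : ∀ {l} → IsArrangement (S ─ x) l → q l ≡ true →
          IsArrangement S (insert l) × p (insert l) ≡ true × insert l ─ x ≡ l
    bwd arr ql with join arr ql
    ... | L₁ , L₂ , refl , ins , pl =
      subst (IsArrangement S) (sym ins) (arrangement-insert L₁ uS x∈S arr) , pl ,
      trans (cong (_─ x) ins) (─-middle L₁ (λ x∈ → proj₂ (∈-─⁻ {S} (IsArrangement.⊆S arr x∈)) refl))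

  arrangement-covers : ∀ {S l x} → Unique S → IsArrangement S l → x ∈ S → x ∈ l
  arrangement-covers {S} {l} {x} uS (arrangement len sub u) x∈S with x ∈? l
  ... | yes x∈l = x∈l
  ... | no  x∉l = contradiction
    (subst (_≤ length (S ─ x)) len
      (length-≤-retract id id u (λ y∈l → ∈-─⁺ (sub y∈l) (λ { refl → x∉l y∈l })) (λ _ → refl)))
    (subst (λ n → ¬ (n ≤ length (S ─ x))) (length-─ uS x∈S) (1+n≰n {length (S ─ x)}))

  startsWith : A → (List A → Bool) → List A → Bool
  startsWith s q []      = false
  startsWith s q (x ∷ l) = does (x ≟ s) ∧ q l

  #arrangements-startsWith : ∀ {S s} q → Unique S → s ∈ S →
                             #arrangements S (startsWith s q) ≡ #arrangements (S ─ s) q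
  #arrangements-startsWith {S} {s} q uS s∈S = #arrangements-remove _ q (s ∷_) uS s∈S split join
    where
    split : ∀ {l} → IsArrangement S l → startsWith s q l ≡ true →
            ∃₂ λ L₁ L₂ → l ≡ L₁ ++ s ∷ L₂ × s ∷ L₁ ++ L₂ ≡ l × q (L₁ ++ L₂) ≡ true
    split {x ∷ l} _ ok with x ≟ s
    split {x ∷ l} _ ok | yes refl = [] , l , refl , refl , ok
    split {x ∷ l} _ () | no _
    join : ∀ {l} → IsArrangement (S ─ s) l → q l ≡ true →
           ∃₂ λ L₁ L₂ → l ≡ L₁ ++ L₂ × s ∷ l ≡ L₁ ++ s ∷ L₂ × startsWith s q (s ∷ l) ≡ true
    join {l} _ ql = [] , l , refl , refl , trans (cong (_∧ q l) (dec-true (s ≟ s) refl)) ql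

  _∉ᵇ_ : A → List A → Bool
  x ∉ᵇ []      = true
  x ∉ᵇ (t ∷ T) = not (does (x ≟ t)) ∧ x ∉ᵇ T

  ∉ᵇ-true : ∀ {x T} → x ∉ T → x ∉ᵇ T ≡ true
  ∉ᵇ-true {T = []}    _  = refl
  ∉ᵇ-true {x} {t ∷ T} x∉ = cong₂ _∧_ (cong not (dec-false (x ≟ t) (x∉ ∘ here))) (∉ᵇ-true (x∉ ∘ there))

  ∉ᵇ-false : ∀ {x T} → x ∈ T → x ∉ᵇ T ≡ false
  ∉ᵇ-false {x} {t ∷ T} (here x≡t) = cong (λ b → not b ∧ x ∉ᵇ T) (dec-true (x ≟ t) x≡t)
  ∉ᵇ-false {x} {t ∷ T} (there x∈) = trans (cong (not (does (x ≟ t)) ∧_) (∉ᵇ-false x∈)) (∧-zeroʳ _)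

  startsOutside : List A → List A → Bool
  startsOutside T []      = true
  startsOutside T (x ∷ l) = x ∉ᵇ T

  #arrangements-startsOutside : ∀ {S c} → Unique S →
    (∀ {s} → s ∈ S → #arrangements (S ─ s) (const true) ≡ c) →
    ∀ T → Unique T → T ⊆ S →
    #arrangements S (const true) ≡ length T * c + #arrangements S (startsOutside T)
  #arrangements-startsOutside {S} uS #rest [] _ _ =
    #arrangements-cong S λ { {[]} _ → refl ; {_ ∷ _} _ → refl }
  #arrangements-startsOutside {S} {c} uS #rest (t ∷ T) (t∉T ∷ uT) T⊆S = begin
    #arrangements S (const true)
      ≡⟨ #arrangements-startsOutside uS #rest T uT (T⊆S ∘ there) ⟩
    length T * c + #arrangements S (startsOutside T)
      ≡⟨ cong (length T * c +_) (#arrangements-split S (startsOutside T) (startsWith t (const true))) ⟩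
    length T * c + (#arrangements S (λ l → startsOutside T l ∧ startsWith t (const true) l)
                   + #arrangements S (λ l → startsOutside T l ∧ not (startsWith t (const true) l)))
      ≡⟨ cong₂ (λ a b → length T * c + (a + b)) starting-with-t other ⟩
    length T * c + (c + #arrangements S (startsOutside (t ∷ T)))
      ≡⟨ sym (+-assoc (length T * c) c _) ⟩
    length T * c + c + #arrangements S (startsOutside (t ∷ T))
      ≡⟨ cong (_+ #arrangements S (startsOutside (t ∷ T))) (+-comm (length T * c) c) ⟩
    c + length T * c + #arrangements S (startsOutside (t ∷ T)) ∎
    where
    open ≡-Reasoning
    starting-with-t : #arrangements S (λ l → startsOutside T l ∧ startsWith t (const true) l) ≡ c
    starting-with-t = trans (#arrangements-cong S agree)
      (trans (#arrangements-startsWith (const true) uS (T⊆S (here refl))) (#rest (T⊆S (here refl))))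
      where
      agree : ∀ {l} → IsArrangement S l →
              (startsOutside T l ∧ startsWith t (const true) l) ≡ startsWith t (const true) l
      agree {[]}    _ = refl
      agree {x ∷ l} _ with x ≟ t
      ... | yes refl = trans (∧-identityʳ _) (∉ᵇ-true (All¬⇒¬Any t∉T))
      ... | no _     = ∧-zeroʳ _
    other : #arrangements S (λ l → startsOutside T l ∧ not (startsWith t (const true) l))
          ≡ #arrangements S (startsOutside (t ∷ T))
    other = #arrangements-cong S λ
      { {[]} _ → refl
      ; {x ∷ l} _ → trans (∧-comm (x ∉ᵇ T) _) (cong (λ b → not b ∧ x ∉ᵇ T) (∧-identityʳ (does (x ≟ t)))) }

  #arrangements-all : ∀ {S} → Unique S → #arrangements S (const true) ≡ length S !
  #arrangements-all uS = by-length _ refl uS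
    where
    open ≡-Reasoning
    by-length : ∀ n {S} → length S ≡ n → Unique S → #arrangements S (const true) ≡ n !
    by-length zero    {[]}    _   _  = refl
    by-length (suc n) {S}     len uS = begin
      #arrangements S (const true)
        ≡⟨ #arrangements-startsOutside uS rest S uS (λ x∈ → x∈) ⟩
      length S * n ! + #arrangements S (startsOutside S)
        ≡⟨ cong₂ _+_ (cong (_* n !) len) (#arrangements-none S _ none) ⟩
      suc n * n ! + 0
        ≡⟨ +-identityʳ _ ⟩
      suc n ! ∎
      where
      rest : ∀ {s} → s ∈ S → #arrangements (S ─ s) (const true) ≡ n !
      rest s∈S = by-length n (suc-injective (trans (length-─ uS s∈S) len)) (─-unique _ uS)
      none : ∀ {l} → IsArrangement S l → startsOutside S l ≡ false
      none {[]}    arr = contradiction (trans (IsArrangement.length≡ arr) len) λ ()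
      none {x ∷ l} arr = ∉ᵇ-false (IsArrangement.⊆S arr (here refl))

  #arrangements-contract : ∀ {S x e} p₀ p q → Unique S → x ∈ S →
    #arrangements S p₀ ≡ #arrangements S p + #arrangements (S ─ x) q →
    #arrangements S p₀ ≡ avoiders (length S) e →
    #arrangements (S ─ x) q ≡ avoiders (length (S ─ x)) e →
    #arrangements S p ≡ avoiders (length S) (suc e)
  #arrangements-contract {S} {x} {e} p₀ p q uS x∈S split deleted contracted =
    subst (λ N → #arrangements S p ≡ avoiders N (suc e)) (length-─ uS x∈S) (begin
      #arrangements S p
        ≡⟨ sym (m+n∸n≡m (#arrangements S p) (#arrangements (S ─ x) q)) ⟩
      #arrangements S p + #arrangements (S ─ x) q ∸ #arrangements (S ─ x) q
        ≡⟨ cong₂ _∸_ (sym split) contracted ⟩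
      #arrangements S p₀ ∸ avoiders (length (S ─ x)) e
        ≡⟨ cong (_∸ avoiders (length (S ─ x)) e)
                (trans deleted (cong (λ N → avoiders N e) (sym (length-─ uS x∈S)))) ⟩
      avoiders (suc (length (S ─ x))) e ∸ avoiders (length (S ─ x)) e ∎)
    where open ≡-Reasoning

  -- Rook boards

  avoidsBoard : List (Maybe A) → List A → Bool
  avoidsBoard (just c  ∷ G) (x ∷ l) = not (does (x ≟ c)) ∧ avoidsBoard G l
  avoidsBoard (nothing ∷ G) (x ∷ l) = avoidsBoard G l
  avoidsBoard _             _       = true

  at : ℕ → A → List A → Bool
  at _       c []      = false
  at zero    c (x ∷ l) = does (x ≟ c)
  at (suc j) c (x ∷ l) = at j c l

  insertAt : ℕ → A → List A → List A
  insertAt zero    c l       = c ∷ l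
  insertAt (suc j) c []      = [ c ]
  insertAt (suc j) c (x ∷ l) = x ∷ insertAt j c l

  at-middle : ∀ c L₁ {L₂} → at (length L₁) c (L₁ ++ c ∷ L₂) ≡ true
  at-middle c []       = dec-true (c ≟ c) refl
  at-middle c (x ∷ L₁) = at-middle c L₁

  at-split : ∀ j c l → at j c l ≡ true → ∃₂ λ L₁ L₂ → l ≡ L₁ ++ c ∷ L₂ × length L₁ ≡ j
  at-split zero c (x ∷ l) ok with x ≟ c
  at-split zero c (x ∷ l) ok | yes refl = [] , l , refl , refl
  at-split zero c (x ∷ l) () | no _
  at-split (suc j) c (x ∷ l) ok with at-split j c l ok
  ... | L₁ , L₂ , refl , refl = x ∷ L₁ , L₂ , refl , refl

  insertAt-middle : ∀ c L₁ {L₂} → insertAt (length L₁) c (L₁ ++ L₂) ≡ L₁ ++ c ∷ L₂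
  insertAt-middle c []       = refl
  insertAt-middle c (x ∷ L₁) = cong (x ∷_) (insertAt-middle c L₁)

  avoidsBoard-++ : ∀ G₁ {G₂} L₁ {L₂} → length G₁ ≡ length L₁ →
                   avoidsBoard (G₁ ++ G₂) (L₁ ++ L₂) ≡ avoidsBoard G₁ L₁ ∧ avoidsBoard G₂ L₂
  avoidsBoard-++ []             []       _   = refl
  avoidsBoard-++ (nothing ∷ G₁) (x ∷ L₁) len = avoidsBoard-++ G₁ L₁ (suc-injective len)
  avoidsBoard-++ (just c  ∷ G₁) (x ∷ L₁) len =
    trans (cong (not (does (x ≟ c)) ∧_) (avoidsBoard-++ G₁ L₁ (suc-injective len)))
          (sym (∧-assoc (not (does (x ≟ c))) _ _))

  avoidsBoard-middle : ∀ G₁ {G₂ c} l → avoidsBoard (G₁ ++ just c ∷ G₂) l ≡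
                       avoidsBoard (G₁ ++ nothing ∷ G₂) l ∧ not (at (length G₁) c l)
  avoidsBoard-middle []             []      = refl
  avoidsBoard-middle [] {G₂} {c}    (x ∷ l) = ∧-comm (not (does (x ≟ c))) (avoidsBoard G₂ l)
  avoidsBoard-middle (nothing ∷ G₁) []      = refl
  avoidsBoard-middle (just _  ∷ G₁) []      = refl
  avoidsBoard-middle (nothing ∷ G₁) (x ∷ l) = avoidsBoard-middle G₁ l
  avoidsBoard-middle (just d  ∷ G₁) {G₂} (x ∷ l) =
    trans (cong (not (does (x ≟ d)) ∧_) (avoidsBoard-middle G₁ l))
          (sym (∧-assoc (not (does (x ≟ d))) (avoidsBoard (G₁ ++ nothing ∷ G₂) l) _))

  #arrangements-avoidsBoard-split : ∀ {S c} G₁ G₂ → Unique S → c ∈ S → length (G₁ ++ just c ∷ G₂) ≡ length S →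
    #arrangements S (avoidsBoard (G₁ ++ nothing ∷ G₂)) ≡
    #arrangements S (avoidsBoard (G₁ ++ just c ∷ G₂)) + #arrangements (S ─ c) (avoidsBoard (G₁ ++ G₂))
  #arrangements-avoidsBoard-split {S} {c} G₁ G₂ uS c∈S len = begin
    #arrangements S avoids₀
      ≡⟨ #arrangements-split S avoids₀ (λ l → not (at j c l)) ⟩
    #arrangements S (λ l → avoids₀ l ∧ not (at j c l)) + #arrangements S (λ l → avoids₀ l ∧ not (not (at j c l)))
      ≡⟨ cong₂ _+_ (#arrangements-cong S λ {l} _ → sym (avoidsBoard-middle G₁ l))
                   (#arrangements-cong S λ {l} _ → cong (avoids₀ l ∧_) (not-involutive (at j c l))) ⟩
    #arrangements S (avoidsBoard (G₁ ++ just c ∷ G₂)) + #arrangements S (λ l → avoids₀ l ∧ at j c l)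
      ≡⟨ cong (#arrangements S (avoidsBoard (G₁ ++ just c ∷ G₂)) +_)
              (#arrangements-remove _ _ (insertAt j c) uS c∈S split join) ⟩
    #arrangements S (avoidsBoard (G₁ ++ just c ∷ G₂)) + #arrangements (S ─ c) (avoidsBoard (G₁ ++ G₂)) ∎
    where
    open ≡-Reasoning
    j : ℕ
    j = length G₁
    avoids₀ : List A → Bool
    avoids₀ = avoidsBoard (G₁ ++ nothing ∷ G₂)
    regroup : ∀ L₁ {L₂} → length L₁ ≡ j →
              avoidsBoard (G₁ ++ G₂) (L₁ ++ L₂) ≡ avoids₀ (L₁ ++ c ∷ L₂)
    regroup L₁ len₁ = trans (avoidsBoard-++ G₁ L₁ (sym len₁)) (sym (avoidsBoard-++ G₁ L₁ (sym len₁)))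
    split : ∀ {l} → IsArrangement S l → (avoids₀ l ∧ at j c l) ≡ true →
            ∃₂ λ L₁ L₂ → l ≡ L₁ ++ c ∷ L₂ × insertAt j c (L₁ ++ L₂) ≡ l × avoidsBoard (G₁ ++ G₂) (L₁ ++ L₂) ≡ true
    split {l} _ ok with avoids₀ l in avoids | at j c l in hit
    ... | true | true with at-split j c l hit
    ...   | L₁ , L₂ , refl , len₁ =
      L₁ , L₂ , refl ,
      subst (λ i → insertAt i c (L₁ ++ L₂) ≡ L₁ ++ c ∷ L₂) len₁ (insertAt-middle c L₁) ,
      trans (regroup L₁ len₁) avoids
    join : ∀ {l} → IsArrangement (S ─ c) l → avoidsBoard (G₁ ++ G₂) l ≡ true →
           ∃₂ λ L₁ L₂ → l ≡ L₁ ++ L₂ × insertAt j c l ≡ L₁ ++ c ∷ L₂ ×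
                        (avoids₀ (insertAt j c l) ∧ at j c (insertAt j c l)) ≡ true
    join {l} arr ok = L₁ , L₂ , sym (take++drop≡id j l) , ins ,
      subst (λ w → (avoids₀ w ∧ at j c w) ≡ true) (sym ins)
        (cong₂ _∧_ (trans (sym (regroup L₁ len₁)) (trans (cong (avoidsBoard (G₁ ++ G₂)) (take++drop≡id j l)) ok))
                   (subst (λ i → at i c (L₁ ++ c ∷ L₂) ≡ true) len₁ (at-middle c L₁)))
      where
      L₁ : List A
      L₁ = take j l
      L₂ : List A
      L₂ = drop j l
      j≤ : j ≤ length l
      j≤ = subst (j ≤_) (suc-injective (trans (sym (length-++-sucʳ G₁ (just c) G₂))
                          (trans len (trans (sym (length-─ uS c∈S)) (cong suc (sym (IsArrangement.length≡ arr)))))))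
                 (subst (j ≤_) (sym (length-++ G₁)) (m≤m+n j (length G₂)))
      len₁ : length L₁ ≡ j
      len₁ = trans (length-take j l) (m≤n⇒m⊓n≡m j≤)
      ins : insertAt j c l ≡ L₁ ++ c ∷ L₂
      ins = trans (cong (insertAt j c) (sym (take++drop≡id j l)))
                  (subst (λ i → insertAt i c (L₁ ++ L₂) ≡ L₁ ++ c ∷ L₂) len₁ (insertAt-middle c L₁))

  record IsBoard (S : List A) (G : List (Maybe A)) : Set where
    constructor board
    field
      length≡ : length G ≡ length S
      unique  : Unique (catMaybes G)
      ⊆S      : catMaybes G ⊆ S

  first-just : ∀ (G : List (Maybe A)) {e} → length (catMaybes G) ≡ suc e →
               ∃₂ λ G₁ c → ∃ λ G₂ → G ≡ G₁ ++ just c ∷ G₂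
  first-just (just c  ∷ G) _ = [] , c , G , refl
  first-just (nothing ∷ G) len with first-just G len
  ... | G₁ , c , G₂ , refl = nothing ∷ G₁ , c , G₂ , refl

  avoidsBoard-blank : ∀ (G : List (Maybe A)) l → length (catMaybes G) ≡ 0 → avoidsBoard G l ≡ true
  avoidsBoard-blank []            l       _     = refl
  avoidsBoard-blank (nothing ∷ G) []      _     = refl
  avoidsBoard-blank (nothing ∷ G) (x ∷ l) blank = avoidsBoard-blank G l blank

  #arrangements-avoidsBoard-step : ∀ {S c e} G₁ G₂ → Unique S → IsBoard S (G₁ ++ just c ∷ G₂) →
    length (catMaybes (G₁ ++ just c ∷ G₂)) ≡ suc e →
    (∀ {S′ G′} → length (catMaybes G′) ≡ e → Unique S′ → IsBoard S′ G′ →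
       #arrangements S′ (avoidsBoard G′) ≡ avoiders (length S′) e) →
    #arrangements S (avoidsBoard (G₁ ++ just c ∷ G₂)) ≡ avoiders (length S) (suc e)
  #arrangements-avoidsBoard-step {S} {c} {e} G₁ G₂ uS (board lenG uG G⊆S) len IH =
    #arrangements-contract _ _ _ uS c∈S (#arrangements-avoidsBoard-split G₁ G₂ uS c∈S lenG)
      (IH (trans (cong length (catMaybes-++ G₁ (nothing ∷ G₂))) rest-length) uS deletion)
      (IH (trans (cong length (catMaybes-++ G₁ G₂)) rest-length) (─-unique c uS) contraction)
    where
    cs≡ : catMaybes (G₁ ++ just c ∷ G₂) ≡ catMaybes G₁ ++ c ∷ catMaybes G₂
    cs≡ = catMaybes-++ G₁ (just c ∷ G₂)
    middle : c ∉ catMaybes G₁ ++ catMaybes G₂ × Unique (catMaybes G₁ ++ catMaybes G₂)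
    middle = Unique-middle⁻ (catMaybes G₁) (subst Unique cs≡ uG)
    ⊆S′ : catMaybes G₁ ++ catMaybes G₂ ⊆ S
    ⊆S′ {x} x∈ = G⊆S (subst (x ∈_) (sym cs≡) (∈-middle⁺ (catMaybes G₁) x∈))
    c∈S : c ∈ S
    c∈S = G⊆S (subst (c ∈_) (sym cs≡) (∈-insert (catMaybes G₁)))
    rest-length : length (catMaybes G₁ ++ catMaybes G₂) ≡ e
    rest-length = suc-injective
      (trans (sym (length-++-sucʳ (catMaybes G₁) c _)) (trans (cong length (sym cs≡)) len))
    deletion : IsBoard S (G₁ ++ nothing ∷ G₂)
    deletion = board
      (trans (length-++-sucʳ G₁ nothing G₂) (trans (sym (length-++-sucʳ G₁ (just c) G₂)) lenG))
      (subst Unique (sym (catMaybes-++ G₁ (nothing ∷ G₂))) (proj₂ middle))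
      (λ {x} x∈ → ⊆S′ (subst (x ∈_) (catMaybes-++ G₁ (nothing ∷ G₂)) x∈))
    contraction : IsBoard (S ─ c) (G₁ ++ G₂)
    contraction = board
      (suc-injective (trans (sym (length-++-sucʳ G₁ (just c) G₂)) (trans lenG (sym (length-─ uS c∈S)))))
      (subst Unique (sym (catMaybes-++ G₁ G₂)) (proj₂ middle))
      (λ {x} x∈ → let x∈′ = subst (x ∈_) (catMaybes-++ G₁ G₂) x∈ in
                  ∈-─⁺ (⊆S′ x∈′) (λ { refl → proj₁ middle x∈′ }))

  #arrangements-avoidsBoard : ∀ {S G} → Unique S → IsBoard S G →
    #arrangements S (avoidsBoard G) ≡ avoiders (length S) (length (catMaybes G))
  #arrangements-avoidsBoard uS B = by-size _ refl uS B
    where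
    by-size : ∀ e {S G} → length (catMaybes G) ≡ e → Unique S → IsBoard S G →
              #arrangements S (avoidsBoard G) ≡ avoiders (length S) e
    by-size zero {S} {G} blank uS _ =
      trans (#arrangements-cong S λ {l} _ → avoidsBoard-blank G l blank) (#arrangements-all uS)
    by-size (suc e) {S} {G} len uS B with first-just G len
    ... | G₁ , c , G₂ , refl = #arrangements-avoidsBoard-step G₁ G₂ uS B len (by-size e)

  -- Arrangements avoiding a system of cyclic adjacencies

  edge : A → A → A → A → Bool
  edge a b x y = does (x ≟ a) ∧ does (y ≟ b)

  isEdge : List (A × A) → A → A → Bool
  isEdge []            x y = false
  isEdge ((a , b) ∷ E) x y = edge a b x y ∨ isEdge E x y

  avoidsAround : A → List (A × A) → List A → Bool
  avoidsAround ∗ E l = avoids (isEdge E) (ring ∗ l)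

  isEdge-∈ : ∀ {x y} E → (x , y) ∈ E → isEdge E x y ≡ true
  isEdge-∈ {x} {y} ((a , b) ∷ E) (here refl) =
    cong (_∨ isEdge E x y) (cong₂ _∧_ (dec-true (x ≟ x) refl) (dec-true (y ≟ y) refl))
  isEdge-∈ {x} {y} ((a , b) ∷ E) (there xy∈) = trans (cong (edge a b x y ∨_) (isEdge-∈ E xy∈)) (∨-zeroʳ _)

  isEdge-∉ : ∀ {x y} E → (x , y) ∉ E → isEdge E x y ≡ false
  isEdge-∉ [] _ = refl
  isEdge-∉ {x} {y} ((a , b) ∷ E) xy∉ = cong₂ _∨_ not-this (isEdge-∉ E (xy∉ ∘ there))
    where
    not-this : edge a b x y ≡ false
    not-this with x ≟ a | y ≟ b
    ... | yes refl | yes refl = contradiction (here refl) xy∉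
    ... | yes _    | no  _    = refl
    ... | no  _    | _        = refl

  avoids-edge-middle : ∀ a b P {w} → avoids (edge a b) (P ++ a ∷ b ∷ w) ≡ false
  avoids-edge-middle a b P {w} =
    trans (avoids-++ (edge a b) P)
          (trans (cong (avoids (edge a b) (P ++ [ a ]) ∧_)
                       (cong (λ c → not c ∧ avoids (edge a b) (b ∷ w))
                             (cong₂ _∧_ (dec-true (a ≟ a) refl) (dec-true (b ≟ b) refl))))
                 (∧-zeroʳ _))

  avoids-edge-absent : ∀ a b x Y → b ∉ Y → avoids (edge a b) (x ∷ Y) ≡ true
  avoids-edge-absent a b x []      _  = refl
  avoids-edge-absent a b x (y ∷ Y) b∉ = cong₂ (λ c d → not c ∧ d)
    (trans (cong (does (x ≟ a) ∧_) (dec-false (y ≟ b) (λ y≡b → b∉ (here (sym y≡b))))) (∧-zeroʳ _))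
    (avoids-edge-absent a b y Y (b∉ ∘ there))

  edge-before : ∀ {a b} x X {Y} → b ∉ X → b ∉ Y → avoids (edge a b) (x ∷ X ++ b ∷ Y) ≡ false →
                ∃ λ P → x ∷ X ≡ P ++ [ a ]
  edge-before {a} {b} x [] {Y} _ b∉Y hit with x ≟ a
  ... | yes refl = [] , refl
  ... | no  _    = contradiction (trans (sym hit) (avoids-edge-absent a b b Y b∉Y)) λ ()
  edge-before {a} {b} x (x′ ∷ X) {Y} b∉X b∉Y hit =
    let P , eq = edge-before x′ X (b∉X ∘ there) b∉Y
                   (trans (sym (cong (λ c → not c ∧ avoids (edge a b) (x′ ∷ X ++ b ∷ Y)) x↛x′)) hit)
    in x ∷ P , cong (x ∷_) eq
    where
    x↛x′ : edge a b x x′ ≡ false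
    x↛x′ = trans (cong (does (x ≟ a) ∧_) (dec-false (x′ ≟ b) (λ x′≡b → b∉X (here (sym x′≡b))))) (∧-zeroʳ _)

  rename : A → A → A → A
  rename b a u = if does (u ≟ b) then a else u

  renameSources : A → A → List (A × A) → List (A × A)
  renameSources b a = map (map₁ (rename b a))

  isEdge-rename-other : ∀ {a b x} y E → x ≢ a → x ≢ b → isEdge E x y ≡ isEdge (renameSources b a E) x y
  isEdge-rename-other y [] _ _ = refl
  isEdge-rename-other {a} {b} {x} y ((u , v) ∷ E) x≢a x≢b with u ≟ b
  ... | yes refl = cong₂ _∨_
    (cong (_∧ does (y ≟ v)) (trans (dec-false (x ≟ u) x≢b) (sym (dec-false (x ≟ a) x≢a))))
    (isEdge-rename-other y E x≢a x≢b)
  ... | no  _    = cong (edge u v x y ∨_) (isEdge-rename-other y E x≢a x≢b)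

  isEdge-rename-source : ∀ {a b} y E → a ∉ map proj₁ E → isEdge (renameSources b a E) a y ≡ isEdge E b y
  isEdge-rename-source y [] _ = refl
  isEdge-rename-source {a} {b} y ((u , v) ∷ E) a∉ with u ≟ b
  ... | yes refl = cong₂ _∨_
    (cong (_∧ does (y ≟ v)) (trans (dec-true (a ≟ a) refl) (sym (dec-true (u ≟ u) refl))))
    (isEdge-rename-source y E (a∉ ∘ there))
  ... | no  u≢b  = cong₂ _∨_
    (cong (_∧ does (y ≟ v)) (trans (dec-false (a ≟ u) (a∉ ∘ here)) (sym (dec-false (b ≟ u) (u≢b ∘ sym)))))
    (isEdge-rename-source y E (a∉ ∘ there))

  isEdge-non-source : ∀ {x} y E → x ∉ map proj₁ E → isEdge E x y ≡ false
  isEdge-non-source y [] _ = refl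
  isEdge-non-source {x} y ((u , v) ∷ E) x∉ =
    cong₂ _∨_ (cong (_∧ does (y ≟ v)) (dec-false (x ≟ u) (x∉ ∘ here))) (isEdge-non-source y E (x∉ ∘ there))

  insertAfter : A → A → List A → List A
  insertAfter a b []      = []
  insertAfter a b (x ∷ w) = if does (x ≟ a) then x ∷ b ∷ w else x ∷ insertAfter a b w

  insertAfter-middle : ∀ {a b} P {w} → a ∉ P → insertAfter a b (P ++ a ∷ w) ≡ P ++ a ∷ b ∷ w
  insertAfter-middle {a} [] _ with a ≟ a
  ... | yes _   = refl
  ... | no  a≢a = contradiction refl a≢a
  insertAfter-middle {a} (p ∷ P) a∉ with p ≟ a
  ... | yes p≡a = contradiction (here (sym p≡a)) a∉
  ... | no  _   = cong (p ∷_) (insertAfter-middle P (a∉ ∘ there))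

  -- Inverse of deleting b: put b right after a in the cyclic word ∗ l (first when a = ∗).
  reinsert : A → A → A → List A → List A
  reinsert ∗ a b l = drop 1 (insertAfter a b (∗ ∷ l))

  prefix-++ : ∀ {∗ a : A} {L₁} P → ∗ ∷ L₁ ≡ P ++ [ a ] → ∀ w → ∗ ∷ L₁ ++ w ≡ P ++ a ∷ w
  prefix-++ {a = a} P eq w = trans (cong (_++ w) eq) (++-assoc P [ a ] w)

  ring-++ : ∀ {∗ a : A} {L₁} P → ∗ ∷ L₁ ≡ P ++ [ a ] → ∀ w → ring ∗ (L₁ ++ w) ≡ P ++ a ∷ w ++ [ ∗ ]
  ring-++ {∗} {L₁ = L₁} P eq w = trans (cong (∗ ∷_) (++-assoc L₁ w [ ∗ ])) (prefix-++ P eq (w ++ [ ∗ ]))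

  unprefix : ∀ {∗ a : A} {l} P {L₂} → ∗ ∷ l ≡ P ++ a ∷ L₂ → ∃ λ L₁ → l ≡ L₁ ++ L₂ × ∗ ∷ L₁ ≡ P ++ [ a ]
  unprefix []      refl = [] , refl , refl
  unprefix {a = a} (p ∷ P) {L₂} refl = P ++ [ a ] , sym (++-assoc P [ a ] L₂) , refl

  reinsert-contract : ∀ {∗ a b} P L₁ L₂ → ∗ ∷ L₁ ≡ P ++ [ a ] → a ∉ P →
                      reinsert ∗ a b (L₁ ++ L₂) ≡ L₁ ++ b ∷ L₂
  reinsert-contract {∗} {a} {b} P L₁ L₂ eq a∉P = cong (drop 1) (begin
    insertAfter a b (∗ ∷ L₁ ++ L₂) ≡⟨ cong (insertAfter a b) (prefix-++ P eq L₂) ⟩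
    insertAfter a b (P ++ a ∷ L₂)  ≡⟨ insertAfter-middle P a∉P ⟩
    P ++ a ∷ b ∷ L₂                ≡⟨ sym (prefix-++ P eq (b ∷ L₂)) ⟩
    ∗ ∷ L₁ ++ b ∷ L₂               ∎)
    where open ≡-Reasoning

  avoidsAround-contract : ∀ {∗ a b} E P L₁ L₂ → a ∉ map proj₁ E → ∗ ∷ L₁ ≡ P ++ [ a ] →
                          a ∉ P ++ L₂ → b ∉ P ++ L₂ →
                          avoidsAround ∗ E (L₁ ++ b ∷ L₂) ≡ avoidsAround ∗ (renameSources b a E) (L₁ ++ L₂)
  avoidsAround-contract {∗} {a} {b} E P L₁ L₂ a∉E eq a∉ b∉ =
    trans (cong (avoids (isEdge E)) (ring-++ P eq (b ∷ L₂)))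
      (trans (avoids-contract P L₂ ∗ (isEdge-non-source b E a∉E) (λ y → isEdge-rename-source y E a∉E)
                (λ y x≢a x≢b → isEdge-rename-other y E x≢a x≢b) (All.zip (∉⇒All≢ a∉ , ∉⇒All≢ b∉)))
             (sym (cong (avoids (isEdge (renameSources b a E))) (ring-++ P eq L₂))))

  adjacent-contract : ∀ {∗ a b} P L₁ L₂ → ∗ ∷ L₁ ≡ P ++ [ a ] → avoids (edge a b) (ring ∗ (L₁ ++ b ∷ L₂)) ≡ false
  adjacent-contract {a = a} {b} P L₁ L₂ eq =
    trans (cong (avoids (edge a b)) (ring-++ P eq (b ∷ L₂))) (avoids-edge-middle a b P)

  split-adjacent : ∀ {∗ a b l} → Unique (∗ ∷ l) → b ∈ l → b ≢ ∗ → avoids (edge a b) (ring ∗ l) ≡ false →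
    ∃₂ λ L₁ L₂ → ∃ λ P → l ≡ L₁ ++ b ∷ L₂ × ∗ ∷ L₁ ≡ P ++ [ a ] × a ∉ P ++ L₂ × b ∉ P ++ L₂
  split-adjacent {∗} {a} {b} u b∈l b≢∗ hit with ∈-∃++ b∈l
  ... | L₁ , L₂ , refl with edge-before ∗ L₁ (b∉ ∘ there ∘ ∈-++⁺ˡ) b∉L₂∗
                              (trans (cong (λ w → avoids (edge a b) (∗ ∷ w)) (sym (++-assoc L₁ (b ∷ L₂) [ ∗ ]))) hit)
    where
    b∉ : b ∉ (∗ ∷ L₁) ++ L₂
    b∉ = proj₁ (Unique-middle⁻ (∗ ∷ L₁) u)
    b∉L₂∗ : b ∉ L₂ ++ [ ∗ ]
    b∉L₂∗ b∈ = [ b∉ ∘ there ∘ ∈-++⁺ʳ L₁ , (λ { (here b≡∗) → b≢∗ b≡∗ }) ]′ (∈-++⁻ L₂ b∈)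
  ...   | P , eq =
    L₁ , L₂ , P , refl , eq , a∉ ∘ ∈-middle⁺ P , proj₁ (Unique-middle⁻ P (proj₂ (Unique-middle⁻ P u′)))
    where
    u′ : Unique (P ++ a ∷ b ∷ L₂)
    u′ = subst Unique (prefix-++ P eq (b ∷ L₂)) u
    a∉ : a ∉ P ++ b ∷ L₂
    a∉ = proj₁ (Unique-middle⁻ P u′)

  split-at : ∀ {∗ a b l} → Unique (∗ ∷ l) → a ∈ ∗ ∷ l → b ∉ ∗ ∷ l →
    ∃₂ λ L₁ L₂ → ∃ λ P → l ≡ L₁ ++ L₂ × ∗ ∷ L₁ ≡ P ++ [ a ] × a ∉ P ++ L₂ × b ∉ P ++ L₂
  split-at {b = b} u a∈ b∉ with ∈-∃++ a∈
  ... | P , L₂ , eq with unprefix P eq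
  ...   | L₁ , refl , eq₁ =
    L₁ , L₂ , P , refl , eq₁ , proj₁ (Unique-middle⁻ P (subst Unique eq u)) ,
    b∉ ∘ subst (b ∈_) (sym eq) ∘ ∈-middle⁺ P

  #arrangements-avoidsAround-split : ∀ {∗ S a b} E → Unique (∗ ∷ S) → a ∈ ∗ ∷ S → b ∈ S → a ≢ b →
    a ∉ map proj₁ E →
    #arrangements S (avoidsAround ∗ E) ≡
    #arrangements S (avoidsAround ∗ ((a , b) ∷ E)) + #arrangements (S ─ b) (avoidsAround ∗ (renameSources b a E))
  #arrangements-avoidsAround-split {∗} {S} {a} {b} E u a∈ b∈S a≢b a∉E = begin
    #arrangements S (avoidsAround ∗ E)
      ≡⟨ #arrangements-split S (avoidsAround ∗ E) apart ⟩
    #arrangements S (λ l → avoidsAround ∗ E l ∧ apart l)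
      + #arrangements S (λ l → avoidsAround ∗ E l ∧ not (apart l))
      ≡⟨ cong₂ _+_ (#arrangements-cong S λ {l} _ → trans (∧-comm (avoidsAround ∗ E l) (apart l))
                                                          (sym (avoids-∨ (edge a b) (isEdge E) (ring ∗ l))))
                   (#arrangements-remove _ _ (reinsert ∗ a b) uS b∈S split join) ⟩
    #arrangements S (avoidsAround ∗ ((a , b) ∷ E)) + #arrangements (S ─ b) (avoidsAround ∗ E′) ∎
    where
    open ≡-Reasoning
    E′ : List (A × A)
    E′ = renameSources b a E
    uS : Unique S
    uS = AllPairs.tail u
    ∗∉S : ∗ ∉ S
    ∗∉S = Unique[x∷xs]⇒x∉xs u
    apart : List A → Bool
    apart l = avoids (edge a b) (ring ∗ l)
    split : ∀ {l} → IsArrangement S l → (avoidsAround ∗ E l ∧ not (apart l)) ≡ true →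
            ∃₂ λ L₁ L₂ → l ≡ L₁ ++ b ∷ L₂ × reinsert ∗ a b (L₁ ++ L₂) ≡ l × avoidsAround ∗ E′ (L₁ ++ L₂) ≡ true
    split {l} arr ok with avoidsAround ∗ E l in good | apart l in hit
    ... | true | false
        with split-adjacent (∉⇒∷-unique ∗∉S (IsArrangement.⊆S arr) (IsArrangement.unique arr))
                            (arrangement-covers uS arr b∈S) (λ { refl → ∗∉S b∈S }) hit
    ...   | L₁ , L₂ , P , refl , eq , a∉ , b∉ =
      L₁ , L₂ , refl , reinsert-contract P L₁ L₂ eq (a∉ ∘ ∈-++⁺ˡ) ,
      trans (sym (avoidsAround-contract E P L₁ L₂ a∉E eq a∉ b∉)) good
    join : ∀ {l} → IsArrangement (S ─ b) l → avoidsAround ∗ E′ l ≡ true →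
           ∃₂ λ L₁ L₂ → l ≡ L₁ ++ L₂ × reinsert ∗ a b l ≡ L₁ ++ b ∷ L₂ ×
                        (avoidsAround ∗ E (reinsert ∗ a b l) ∧ not (apart (reinsert ∗ a b l))) ≡ true
    join {l} arr ok
        with split-at (∉⇒∷-unique (∗∉S ∘ proj₁ ∘ ∈-─⁻ {S}) (IsArrangement.⊆S arr) (IsArrangement.unique arr))
                      a∈∗l b∉∗l
      where
      a∈∗l : a ∈ ∗ ∷ l
      a∈∗l = [ here , (λ a∈S → there (arrangement-covers (─-unique b uS) arr (∈-─⁺ a∈S a≢b))) ]′ (Any.toSum a∈)
      b∉∗l : b ∉ ∗ ∷ l
      b∉∗l (here b≡∗)  = ∗∉S (subst (_∈ S) b≡∗ b∈S)
      b∉∗l (there b∈l) = proj₂ (∈-─⁻ {S} (IsArrangement.⊆S arr b∈l)) refl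
    ... | L₁ , L₂ , P , refl , eq , a∉ , b∉ =
      L₁ , L₂ , refl , ins ,
      subst (λ w → (avoidsAround ∗ E w ∧ not (apart w)) ≡ true) (sym ins)
            (cong₂ (λ c d → c ∧ not d) (trans (avoidsAround-contract E P L₁ L₂ a∉E eq a∉ b∉) ok)
                                       (adjacent-contract P L₁ L₂ eq))
      where ins = reinsert-contract P L₁ L₂ eq (a∉ ∘ ∈-++⁺ˡ)

  -- Distinct sources, distinct targets and a rank increasing along edges: the forbidden
  -- adjacencies form disjoint paths, and contracting one edge yields a system of the same kind.
  record IsPathSystem (∗ : A) (S : List A) (E : List (A × A)) : Set where
    constructor pathSystem
    field
      rank      : A → ℕ
      unique    : Unique (∗ ∷ S)
      sources   : Unique (map proj₁ E)
      targets   : Unique (map proj₂ E)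
      ascending : All (λ e → rank (proj₁ e) < rank (proj₂ e)) E
      endpoints : All (λ e → proj₁ e ∈ ∗ ∷ S × proj₂ e ∈ ∗ ∷ S) E

  rename-injective : ∀ {a b x y} → x ≢ a → y ≢ a → rename b a x ≡ rename b a y → x ≡ y
  rename-injective {a} {b} {x} {y} x≢a y≢a eq with x ≟ b | y ≟ b
  ... | yes x≡b | yes y≡b = trans x≡b (sym y≡b)
  ... | yes _   | no  _   = contradiction (sym eq) y≢a
  ... | no  _   | yes _   = contradiction eq x≢a
  ... | no  _   | no  _   = eq

  rename-unique : ∀ {a b} xs → a ∉ xs → Unique xs → Unique (map (rename b a) xs)
  rename-unique []       _  []       = []
  rename-unique (x ∷ xs) a∉ (x∉ ∷ u) =
    All.map⁺ (All.map (λ (x≢y , y≢a) eq → x≢y (rename-injective (λ x≡a → a∉ (here (sym x≡a))) y≢a eq))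
                      (All.zip (x∉ , ∉⇒All≢ (a∉ ∘ there))))
    ∷ rename-unique xs (a∉ ∘ there) u

  ∈-∷─ : ∀ {∗ S b v} → v ∈ ∗ ∷ S → v ≢ b → v ∈ ∗ ∷ (S ─ b)
  ∈-∷─ v∈ v≢b = [ here , (λ v∈S → there (∈-─⁺ v∈S v≢b)) ]′ (Any.toSum v∈)

  module _ {∗ S a b E} (sys : IsPathSystem ∗ S ((a , b) ∷ E)) (b≢∗ : b ≢ ∗) where
    open IsPathSystem sys

    a∈∗∷S : a ∈ ∗ ∷ S
    a∈∗∷S = proj₁ (All.head endpoints)

    b∈S : b ∈ S
    b∈S = [ (λ b≡∗ → contradiction b≡∗ b≢∗) , id ]′ (Any.toSum (proj₂ (All.head endpoints)))

    a≢b : a ≢ b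
    a≢b refl = <-irrefl refl (All.head ascending)

    pathSystem-delete : IsPathSystem ∗ S E
    pathSystem-delete = pathSystem rank unique (AllPairs.tail sources) (AllPairs.tail targets)
                                   (All.tail ascending) (All.tail endpoints)

    pathSystem-contract : IsPathSystem ∗ (S ─ b) (renameSources b a E)
    pathSystem-contract = pathSystem rank
      (∉⇒∷-unique (Unique[x∷xs]⇒x∉xs unique) (proj₁ ∘ ∈-─⁻ {S}) (─-unique b (AllPairs.tail unique)))
      (subst Unique (trans (sym (map-∘ {g = rename b a} {f = proj₁} E))
                           (map-∘ {g = proj₁} {f = map₁ (rename b a)} E))
             (rename-unique (map proj₁ E) (Unique[x∷xs]⇒x∉xs sources) (AllPairs.tail sources)))
      (subst Unique (map-∘ {g = proj₂} {f = map₁ (rename b a)} E) (AllPairs.tail targets))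
      (All.map⁺ (All.map renamed-ascending (All.tail ascending)))
      (All.map⁺ (All.map renamed-endpoints
        (All.zip (All.tail endpoints , All.map⁻ (∉⇒All≢ (Unique[x∷xs]⇒x∉xs targets))))))
      where
      renamed-ascending : ∀ {e} → rank (proj₁ e) < rank (proj₂ e) → rank (rename b a (proj₁ e)) < rank (proj₂ e)
      renamed-ascending {u , v} u<v with u ≟ b
      ... | yes refl = <-trans (All.head ascending) u<v
      ... | no  _    = u<v
      renamed-endpoints : ∀ {e} → (proj₁ e ∈ ∗ ∷ S × proj₂ e ∈ ∗ ∷ S) × proj₂ e ≢ b →
                          rename b a (proj₁ e) ∈ ∗ ∷ (S ─ b) × proj₂ e ∈ ∗ ∷ (S ─ b)
      renamed-endpoints {u , v} ((u∈ , v∈) , v≢b) with u ≟ b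
      ... | yes _   = ∈-∷─ a∈∗∷S a≢b , ∈-∷─ v∈ v≢b
      ... | no  u≢b = ∈-∷─ u∈ u≢b , ∈-∷─ v∈ v≢b

    #arrangements-avoidsAround-contract : ∀ {e} → length E ≡ e →
      (∀ {S′ E′} → length E′ ≡ e → IsPathSystem ∗ S′ E′ →
         #arrangements S′ (avoidsAround ∗ E′) ≡ avoiders (length S′) e) →
      #arrangements S (avoidsAround ∗ ((a , b) ∷ E)) ≡ avoiders (length S) (suc e)
    #arrangements-avoidsAround-contract len IH =
      #arrangements-contract _ _ _ (AllPairs.tail unique) b∈S
        (#arrangements-avoidsAround-split E unique a∈∗∷S b∈S a≢b (Unique[x∷xs]⇒x∉xs sources))
        (IH len pathSystem-delete) (IH (trans (length-map _ E) len) pathSystem-contract)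

  #arrangements-avoidsAround-last : ∀ {∗ S a} → Unique (∗ ∷ S) → a ∈ S →
    #arrangements S (avoidsAround ∗ [ (a , ∗) ]) ≡ avoiders (length S) 1
  #arrangements-avoidsAround-last {∗} {S} {a} (∗∉S′ ∷ uS) a∈S =
    #arrangements-contract (const true) around (const true) uS a∈S
      (trans (#arrangements-split S (const true) around)
             (cong (#arrangements S around +_) (#arrangements-remove _ _ (_++ [ a ]) uS a∈S split join)))
      (#arrangements-all uS) (#arrangements-all (─-unique a uS))
    where
    around : List A → Bool
    around = avoidsAround ∗ [ (a , ∗) ]
    ∗∉S : ∗ ∉ S
    ∗∉S = All¬⇒¬Any ∗∉S′
    around≡ : ∀ l → around l ≡ avoids (edge a ∗) (ring ∗ l)
    around≡ l = trans (avoids-∨ (edge a ∗) (isEdge []) (ring ∗ l))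
                      (trans (cong (avoids (edge a ∗) (ring ∗ l) ∧_) (avoids-never (ring ∗ l))) (∧-identityʳ _))
    ends-with-a : ∀ P {l} → ∗ ∷ l ≡ P ++ [ a ] → ∃ λ L₁ → l ≡ L₁ ++ [ a ]
    ends-with-a []      refl = contradiction a∈S ∗∉S
    ends-with-a (_ ∷ P) refl = P , refl
    split : ∀ {l} → IsArrangement S l → not (around l) ≡ true →
            ∃₂ λ L₁ L₂ → l ≡ L₁ ++ a ∷ L₂ × (L₁ ++ L₂) ++ [ a ] ≡ l × true ≡ true
    split {l} arr ok with around l in hit
    ... | false with edge-before ∗ l (∗∉S ∘ IsArrangement.⊆S arr) (λ ()) (trans (sym (around≡ l)) hit)
    ...   | P , eq with ends-with-a P eq
    ...     | L₁ , refl = L₁ , [] , refl , cong (_++ [ a ]) (++-identityʳ L₁) , refl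
    join : ∀ {l} → IsArrangement (S ─ a) l → true ≡ true →
           ∃₂ λ L₁ L₂ → l ≡ L₁ ++ L₂ × l ++ [ a ] ≡ L₁ ++ a ∷ L₂ × not (around (l ++ [ a ])) ≡ true
    join {l} _ _ = l , [] , sym (++-identityʳ l) , refl ,
      cong not (trans (around≡ (l ++ [ a ]))
                      (trans (cong (λ w → avoids (edge a ∗) (∗ ∷ w)) (++-assoc l [ a ] [ ∗ ]))
                             (avoids-edge-middle a ∗ (∗ ∷ l))))

  avoidsAround-swap : ∀ ∗ e f E l → avoidsAround ∗ (e ∷ f ∷ E) l ≡ avoidsAround ∗ (f ∷ e ∷ E) l
  avoidsAround-swap ∗ (a , b) (c , d) E l = begin
    avoids (isEdge ((a , b) ∷ (c , d) ∷ E)) w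
      ≡⟨ avoids-∨ (edge a b) (isEdge ((c , d) ∷ E)) w ⟩
    x ∧ avoids (isEdge ((c , d) ∷ E)) w
      ≡⟨ cong (x ∧_) (avoids-∨ (edge c d) (isEdge E) w) ⟩
    x ∧ (y ∧ z)
      ≡⟨ sym (∧-assoc x y z) ⟩
    (x ∧ y) ∧ z
      ≡⟨ cong (_∧ z) (∧-comm x y) ⟩
    (y ∧ x) ∧ z
      ≡⟨ ∧-assoc y x z ⟩
    y ∧ (x ∧ z)
      ≡⟨ cong (y ∧_) (sym (avoids-∨ (edge a b) (isEdge E) w)) ⟩
    y ∧ avoids (isEdge ((a , b) ∷ E)) w
      ≡⟨ sym (avoids-∨ (edge c d) (isEdge ((a , b) ∷ E)) w) ⟩
    avoids (isEdge ((c , d) ∷ (a , b) ∷ E)) w ∎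
    where
    open ≡-Reasoning
    w : List A
    w = ring ∗ l
    x : Bool
    x = avoids (edge a b) w
    y : Bool
    y = avoids (edge c d) w
    z : Bool
    z = avoids (isEdge E) w

  pathSystem-swap : ∀ {∗ S e f E} → IsPathSystem ∗ S (e ∷ f ∷ E) → IsPathSystem ∗ S (f ∷ e ∷ E)
  pathSystem-swap (pathSystem rank unique sources targets (e↑ ∷ f↑ ∷ ↑) (e∈ ∷ f∈ ∷ ∈S)) =
    pathSystem rank unique (swap sources) (swap targets) (f↑ ∷ e↑ ∷ ↑) (f∈ ∷ e∈ ∷ ∈S)
    where
    swap : ∀ {x y : A} {xs} → Unique (x ∷ y ∷ xs) → Unique (y ∷ x ∷ xs)
    swap ((x≢y ∷ x∉) ∷ y∉ ∷ u) = ((x≢y ∘ sym) ∷ y∉) ∷ x∉ ∷ u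

  -- An edge into the marker cannot be contracted by deleting its target; it is moved behind
  -- another edge, or counted directly when it is the only one.
  #arrangements-avoidsAround : ∀ {∗ S E} → IsPathSystem ∗ S E →
    #arrangements S (avoidsAround ∗ E) ≡ avoiders (length S) (length E)
  #arrangements-avoidsAround sys = by-size _ refl sys
    where
    by-size : ∀ e {∗ S E} → length E ≡ e → IsPathSystem ∗ S E →
              #arrangements S (avoidsAround ∗ E) ≡ avoiders (length S) e
    by-size zero {∗} {S} {[]} _ sys =
      trans (#arrangements-cong S λ {l} _ → avoids-never (ring ∗ l))
            (#arrangements-all (AllPairs.tail (IsPathSystem.unique sys)))
    by-size (suc e) {∗} {S} {(a , b) ∷ E} len sys with b ≟ ∗
    by-size (suc e) {∗} {S} {(a , b) ∷ E} len sys | no b≢∗ =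
      #arrangements-avoidsAround-contract sys b≢∗ (suc-injective len) (by-size e)
    by-size (suc e) {∗} {S} {(a , ∗) ∷ []} len sys | yes refl =
      subst (λ e → #arrangements S (avoidsAround ∗ [ (a , ∗) ]) ≡ avoiders (length S) (suc e)) (suc-injective len)
        (#arrangements-avoidsAround-last unique
          ([ (λ a≡∗ → contradiction a≡∗ (λ { refl → <-irrefl refl (All.head ascending) })) , id ]′
             (Any.toSum (proj₁ (All.head endpoints)))))
      where open IsPathSystem sys
    by-size (suc e) {∗} {S} {(a , ∗) ∷ (c , d) ∷ E} len sys | yes refl =
      trans (#arrangements-cong S λ {l} _ → avoidsAround-swap ∗ (a , ∗) (c , d) E l)
            (#arrangements-avoidsAround-contract (pathSystem-swap sys) d≢∗ (suc-injective len) (by-size e))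
      where
      d≢∗ : d ≢ ∗
      d≢∗ = All.head (AllPairs.head (IsPathSystem.targets sys)) ∘ sym

-- Permutations of [N] as arrangements of upTo N

open Arrangements ℕ._≟_
open import Data.List.Relation.Unary.Unique.DecPropositional ℕ._≟_ using (unique?)

true⇒ : ∀ {P : Set} (P? : Dec P) → does P? ≡ true → P
true⇒ (yes p) _  = p
true⇒ (no _)  ()

false⇒¬ : ∀ {P : Set} (P? : Dec P) → does P? ≡ false → ¬ P
false⇒¬ (no ¬p) _  = ¬p
false⇒¬ (yes _) ()

does-≡ : ∀ {P : Set} (P? : Dec P) {b} → (P → b ≡ true) → (b ≡ true → P) → does P? ≡ b
does-≡ (yes p) {true}  _  _  = refl
does-≡ (yes p) {false} ⇒b _  = sym (⇒b p)
does-≡ (no ¬p) {true}  _  b⇒ = contradiction (b⇒ refl) ¬p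
does-≡ (no ¬p) {false} _  _  = refl

not≡true : ∀ {a} → not a ≡ true → a ≡ false
not≡true {false} _  = refl
not≡true {true}  ()

∧≡true : ∀ {a b} → a ∧ b ≡ true → a ≡ true × b ≡ true
∧≡true {true}  {true}  _  = refl , refl
∧≡true {true}  {false} ()
∧≡true {false} ()

values : ∀ {n m} → Vec (Fin n) m → List ℕ
values v = map toℕ (Vec.toList v)

∈-values⁺ : ∀ {n m} (v : Vec (Fin n) m) i → toℕ (lookup v i) ∈ values v
∈-values⁺ (x ∷ v) zero    = here refl
∈-values⁺ (x ∷ v) (suc i) = there (∈-values⁺ v i)

∈-values⁻ : ∀ {n m} (v : Vec (Fin n) m) {y} → y ∈ values v → ∃ λ i → y ≡ toℕ (lookup v i)
∈-values⁻ (x ∷ v) (here refl) = zero , refl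
∈-values⁻ (x ∷ v) (there y∈)  = let i , eq = ∈-values⁻ v y∈ in suc i , eq

values-unique⁺ : ∀ {n m} (v : Vec (Fin n) m) → (∀ i j → lookup v i ≡ lookup v j → i ≡ j) → Unique (values v)
values-unique⁺ []      _   = []
values-unique⁺ (x ∷ v) inj =
  ¬Any⇒All¬ (values v) x∉ ∷ values-unique⁺ v (λ i j eq → Finₚ.suc-injective (inj (suc i) (suc j) eq))
  where
  x∉ : toℕ x ∉ values v
  x∉ x∈ with ∈-values⁻ v x∈
  ... | j , eq with inj zero (suc j) (toℕ-injective eq)
  ... | ()

values-unique⁻ : ∀ {n m} (v : Vec (Fin n) m) → Unique (values v) → ∀ i j → lookup v i ≡ lookup v j → i ≡ j
values-unique⁻ (x ∷ v) _        zero    zero    _  = refl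
values-unique⁻ (x ∷ v) (x∉ ∷ _) zero    (suc j) eq =
  contradiction (∈-values⁺ v j) (subst (_∉ values v) (cong toℕ eq) (All¬⇒¬Any x∉))
values-unique⁻ (x ∷ v) (x∉ ∷ _) (suc i) zero    eq =
  contradiction (∈-values⁺ v i) (subst (_∉ values v) (cong toℕ (sym eq)) (All¬⇒¬Any x∉))
values-unique⁻ (x ∷ v) (_ ∷ u)  (suc i) (suc j) eq = cong suc (values-unique⁻ v u i j eq)

avoids-values⁻ : ∀ R {n m} (v : Vec (Fin n) m) → avoids R (values v) ≡ true →
  ∀ i j → toℕ j ≡ suc (toℕ i) → R (toℕ (lookup v i)) (toℕ (lookup v j)) ≡ false
avoids-values⁻ R (x ∷ [])    ok zero    zero          ()
avoids-values⁻ R (x ∷ y ∷ v) ok zero    zero          ()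
avoids-values⁻ R (x ∷ y ∷ v) ok zero    (suc zero)    _  = not≡true (proj₁ (∧≡true ok))
avoids-values⁻ R (x ∷ y ∷ v) ok zero    (suc (suc j)) ()
avoids-values⁻ R (x ∷ y ∷ v) ok (suc i) zero          ()
avoids-values⁻ R (x ∷ y ∷ v) ok (suc i) (suc j)       eq =
  avoids-values⁻ R (y ∷ v) (proj₂ (∧≡true ok)) i j (suc-injective eq)

avoids-values⁺ : ∀ R {n m} (v : Vec (Fin n) m) →
  (∀ i j → toℕ j ≡ suc (toℕ i) → R (toℕ (lookup v i)) (toℕ (lookup v j)) ≡ false) → avoids R (values v) ≡ true
avoids-values⁺ R []          _     = refl
avoids-values⁺ R (x ∷ [])    _     = refl
avoids-values⁺ R (x ∷ y ∷ v) apart = cong₂ (λ c d → not c ∧ d) (apart zero (suc zero) refl)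
  (avoids-values⁺ R (y ∷ v) λ i j eq → apart (suc i) (suc j) (cong suc eq))

lookup-last : ∀ {n m} (x : Fin n) (w : Vec (Fin n) m) → toℕ (lookup (x ∷ w) (fromℕ m)) ≡ lastOr (toℕ x) (values w)
lookup-last x []      = refl
lookup-last x (y ∷ w) = lookup-last y w

avoidsBoard-values⁻ : ∀ (g : ℕ → ℕ) {n m} (v : Vec (Fin n) m) →
  avoidsBoard (map just (applyUpTo g m)) (values v) ≡ true → ∀ i → toℕ (lookup v i) ≢ g (toℕ i)
avoidsBoard-values⁻ g (x ∷ v) ok zero    = false⇒¬ (toℕ x ℕ.≟ g 0) (not≡true (proj₁ (∧≡true ok)))
avoidsBoard-values⁻ g (x ∷ v) ok (suc i) = avoidsBoard-values⁻ (g ∘ suc) v (proj₂ (∧≡true ok)) i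

avoidsBoard-values⁺ : ∀ (g : ℕ → ℕ) {n m} (v : Vec (Fin n) m) →
  (∀ i → toℕ (lookup v i) ≢ g (toℕ i)) → avoidsBoard (map just (applyUpTo g m)) (values v) ≡ true
avoidsBoard-values⁺ g []      _   = refl
avoidsBoard-values⁺ g (x ∷ v) off = cong₂ _∧_ (cong not (dec-false (toℕ x ℕ.≟ g 0) (off zero)))
  (avoidsBoard-values⁺ (g ∘ suc) v (off ∘ suc))

values-allVecs : ∀ {n} (xs : List (Fin n)) m → map values (allVecs xs m) ≡ words (map toℕ xs) m
values-allVecs xs zero    = refl
values-allVecs {n} xs (suc m) =
  trans (prepend xs) (cong (λ W → concatMap (λ y → map (y ∷_) W) (map toℕ xs)) (values-allVecs xs m))
  where
  W : List (Vec (Fin n) m)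
  W = allVecs xs m
  prepend : ∀ ys → map values (concatMap (λ x → map (x ∷_) W) ys) ≡
                   concatMap (λ y → map (y ∷_) (map values W)) (map toℕ ys)
  prepend []       = refl
  prepend (x ∷ ys) = trans (map-++ values (map (x ∷_) W) _)
    (cong₂ _++_ (trans (sym (map-∘ {g = values} {f = x ∷_} W)) (map-∘ {g = toℕ x ∷_} {f = values} W)) (prepend ys))

map-toℕ-tabulate : ∀ {N} n (f : Fin n → Fin N) (g : ℕ → ℕ) → (∀ i → toℕ (f i) ≡ g (toℕ i)) →
                   map toℕ (tabulate f) ≡ applyUpTo g n
map-toℕ-tabulate zero    f g _  = refl
map-toℕ-tabulate (suc n) f g eq = cong₂ _∷_ (eq zero) (map-toℕ-tabulate n (f ∘ suc) (g ∘ suc) (eq ∘ suc))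

countᵇ-perms : ∀ N (f : Vec (Fin N) N → Bool) (q : List ℕ → Bool) → (∀ p → f p ≡ q (values p)) →
               countᵇ f (perms N) ≡ #arrangements (upTo N) q
countᵇ-perms N f q f≗q = begin
  countᵇ f (filter isPerm? V)
    ≡⟨ countᵇ-filter isPerm? f V ⟩
  countᵇ (λ p → does (isPerm? p) ∧ f p) V
    ≡⟨ countᵇ-cong V (λ {p} _ → cong₂ _∧_ (perm≡unique p) (f≗q p)) ⟩
  countᵇ (arranged ∘ values) V
    ≡⟨ sym (countᵇ-map arranged values V) ⟩
  countᵇ arranged (map values V)
    ≡⟨ cong (countᵇ arranged) (values-allVecs (allFin N) N) ⟩
  countᵇ arranged (words (map toℕ (allFin N)) N)
    ≡⟨ cong (λ S → countᵇ arranged (words S N)) (map-toℕ-tabulate N id id (λ _ → refl)) ⟩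
  countᵇ arranged (words (upTo N) N)
    ≡⟨ cong (λ m → countᵇ arranged (words (upTo N) m)) (sym (length-upTo N)) ⟩
  #arrangements (upTo N) q ∎
  where
  open ≡-Reasoning
  V : List (Vec (Fin N) N)
  V = allVecs (allFin N) N
  arranged : List ℕ → Bool
  arranged l = does (unique? l) ∧ q l
  perm≡unique : ∀ p → does (isPerm? p) ≡ does (unique? (values p))
  perm≡unique p = does-≡ (isPerm? p) (dec-true (unique? (values p)) ∘ values-unique⁺ p)
                                     (values-unique⁻ p ∘ true⇒ (unique? (values p)))

succession : ℕ → ℕ → ℕ → Bool
succession k x y = does (y ℕ.≟ x + k)

noSucc≡ : ∀ k {N} (p : Vec (Fin N) N) → does (noSucc? k p) ≡ avoids (succession k) (values p)
noSucc≡ k p = does-≡ (noSucc? k p)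
  (λ ns → avoids-values⁺ (succession k) p λ i j j≡ → dec-false (_ ℕ.≟ _) (ns i j j≡))
  (λ ok i j j≡ → false⇒¬ (_ ℕ.≟ _) (avoids-values⁻ (succession k) p ok i j j≡))

noCyc≡ : ∀ k {N} (x : Fin (suc N)) (w : Vec (Fin (suc N)) N) →
         does (noCyc? k (x ∷ w)) ≡ not (succession k (lastOr (toℕ x) (values w)) (toℕ x))
noCyc≡ k {N} x w = does-≡ (noCyc? k (x ∷ w))
  (λ nc → cong not (dec-false (_ ℕ.≟ _)
            (subst (λ z → toℕ x ≢ z + k) (lookup-last x w) (nc zero (fromℕ N) refl (toℕ-fromℕ N)))))
  (λ ok i j i≡0 j≡N →
     let open-cycle = subst (λ z → toℕ x ≢ z + k) (sym (lookup-last x w)) (false⇒¬ (_ ℕ.≟ _) (not≡true ok)) in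
     subst₂ (λ i j → val (x ∷ w) i ≢ val (x ∷ w) j + k)
            (sym (toℕ-injective {j = zero} i≡0)) (sym (toℕ-injective (trans j≡N (sym (toℕ-fromℕ N))))) open-cycle)

successions : ℕ → ℕ → List (ℕ × ℕ)
successions k n = map (λ x → (x , x + k)) (upTo (n ∸ k))

<∸⇒+< : ∀ u k n → u < n ∸ k → u + k < n
<∸⇒+< u zero    n       lt = subst (_< n) (sym (+-identityʳ u)) lt
<∸⇒+< u (suc k) (suc n) lt = subst (_< suc n) (sym (+-suc u k)) (s≤s (<∸⇒+< u k n lt))

∈-successions⁻ : ∀ {k n u v} → (u , v) ∈ successions k n → u + k < n × v ≡ u + k
∈-successions⁻ {k} {n} uv∈ with ∈-map⁻ (λ x → (x , x + k)) uv∈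
... | u , u∈ , refl = <∸⇒+< u k n (∈-upTo⁻ u∈) , refl

∈-successions⁺ : ∀ {k n u} → u + k < n → (u , u + k) ∈ successions k n
∈-successions⁺ {k} {n} {u} lt = ∈-map⁺ (λ x → (x , x + k)) (∈-upTo⁺ (m+n≤o⇒m≤o∸n (suc u) lt))

isEdge-successions : ∀ {k n x y} → y < n → isEdge (successions k n) x y ≡ succession k x y
isEdge-successions {k} {n} {x} {y} y<n with y ℕ.≟ x + k
... | yes refl = trans (isEdge-∈ (successions k n) (∈-successions⁺ y<n)) (sym (dec-true (y ℕ.≟ x + k) refl))
... | no  y≢   = trans (isEdge-∉ (successions k n) (y≢ ∘ proj₂ ∘ ∈-successions⁻)) (sym (dec-false (y ℕ.≟ x + k) y≢))

avoids-successions : ∀ {k n} w → (∀ {x} → x ∈ w → x < n) →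
                     avoids (isEdge (successions k n)) w ≡ avoids (succession k) w
avoids-successions {k} {n} w bounded =
  avoids-cong-∈ w λ {x} {y} _ y∈ → isEdge-successions {k} {n} {x} {y} (bounded y∈)

successions-pathSystem : ∀ {k n ∗ S} → 1 ≤ k → Unique (∗ ∷ S) → (∀ {x} → x < n → x ∈ ∗ ∷ S) →
                         IsPathSystem ∗ S (successions k n)
successions-pathSystem {k} {n} k≥1 u cover = pathSystem id u
  (subst Unique (map-∘ {g = proj₁} {f = f} xs) (subst Unique (sym (map-id xs)) (upTo⁺ (n ∸ k))))
  (subst Unique (map-∘ {g = proj₂} {f = f} xs) (Unique.map⁺ (+-cancelʳ-≡ k _ _) (upTo⁺ (n ∸ k))))
  (All.map⁺ (All.tabulate λ {x} _ → m<m+n x k≥1))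
  (All.map⁺ (All.tabulate λ {x} x∈ → let x+k<n = <∸⇒+< x k n (∈-upTo⁻ x∈) in
                                      cover (≤-<-trans (m≤m+n x k) x+k<n) , cover x+k<n))
  where
  xs : List ℕ
  xs = upTo (n ∸ k)
  f : ℕ → ℕ × ℕ
  f = λ x → (x , x + k)

countFirst≡#arrangements : ∀ k {n} (i : Fin (suc n)) →
  countFirst k (suc n) i ≡ #arrangements (upTo (suc n)) (startsWith (toℕ i) (avoids (succession k) ∘ ring (toℕ i)))
countFirst≡#arrangements k {n} i = begin
  countFirst k (suc n) i
    ≡⟨ length-filter≡countᵇ (λ p → lookup p zero Fin.≟ i) (dstar k (suc n)) ⟩
  countᵇ (λ p → does (lookup p zero Fin.≟ i)) (filter (λ p → noSucc? k p ×-dec noCyc? k p) (perms (suc n)))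
    ≡⟨ countᵇ-filter (λ p → noSucc? k p ×-dec noCyc? k p) _ (perms (suc n)) ⟩
  countᵇ (λ p → (does (noSucc? k p) ∧ does (noCyc? k p)) ∧ does (lookup p zero Fin.≟ i)) (perms (suc n))
    ≡⟨ countᵇ-perms (suc n) _ _ bridge ⟩
  #arrangements (upTo (suc n)) (startsWith ∗ (avoids (succession k) ∘ ring ∗)) ∎
  where
  open ≡-Reasoning
  ∗ : ℕ
  ∗ = toℕ i
  bridge : ∀ p → ((does (noSucc? k p) ∧ does (noCyc? k p)) ∧ does (lookup p zero Fin.≟ i))
                 ≡ startsWith ∗ (avoids (succession k) ∘ ring ∗) (values p)
  bridge (x ∷ w) with x Fin.≟ i
  ... | yes refl = trans (∧-identityʳ _)
    (trans (cong₂ _∧_ (noSucc≡ k (x ∷ w)) (noCyc≡ k x w))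
           (trans (sym (avoids-∷ʳ (succession k) (toℕ x) (values w)))
                  (sym (cong (_∧ avoids (succession k) (ring ∗ (values w))) (dec-true (∗ ℕ.≟ ∗) refl)))))
  ... | no  x≢i  = trans (∧-zeroʳ _)
    (sym (cong (_∧ avoids (succession k) (ring ∗ (values w))) (dec-false (toℕ x ℕ.≟ ∗) (x≢i ∘ toℕ-injective))))

first-entry-count : ∀ {n k} → 1 ≤ k → (i : Fin n) → countFirst k n i ≡ avoiders (n ∸ 1) (n ∸ k)
first-entry-count {suc n} {k} k≥1 i = begin
  countFirst k (suc n) i
    ≡⟨ countFirst≡#arrangements k i ⟩
  #arrangements (upTo (suc n)) (startsWith ∗ (avoids (succession k) ∘ ring ∗))
    ≡⟨ #arrangements-cong (upTo (suc n)) around ⟩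
  #arrangements (upTo (suc n)) (startsWith ∗ (avoidsAround ∗ (successions k (suc n))))
    ≡⟨ #arrangements-startsWith _ (upTo⁺ (suc n)) ∗∈ ⟩
  #arrangements (upTo (suc n) ─ ∗) (avoidsAround ∗ (successions k (suc n)))
    ≡⟨ #arrangements-avoidsAround (successions-pathSystem k≥1 unique cover) ⟩
  avoiders (length (upTo (suc n) ─ ∗)) (length (successions k (suc n)))
    ≡⟨ cong₂ avoiders (suc-injective (trans (length-─ (upTo⁺ (suc n)) ∗∈) (length-upTo (suc n))))
                      (trans (length-map _ (upTo (suc n ∸ k))) (length-upTo (suc n ∸ k))) ⟩
  avoiders n (suc n ∸ k) ∎
  where
  open ≡-Reasoning
  ∗ : ℕ
  ∗ = toℕ i
  ∗∈ : ∗ ∈ upTo (suc n)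
  ∗∈ = ∈-upTo⁺ (toℕ<n i)
  around : ∀ {l} → IsArrangement (upTo (suc n)) l →
           startsWith ∗ (avoids (succession k) ∘ ring ∗) l ≡
           startsWith ∗ (avoidsAround ∗ (successions k (suc n))) l
  around {[]}    _   = refl
  around {x ∷ l} arr = cong (does (x ℕ.≟ ∗) ∧_) (sym (avoids-successions (ring ∗ l) bounded))
    where
    bounded : ∀ {y} → y ∈ ring ∗ l → y < suc n
    bounded (here refl) = toℕ<n i
    bounded (there y∈)  = [ ∈-upTo⁻ ∘ IsArrangement.⊆S arr ∘ there , (λ { (here refl) → toℕ<n i }) ]′ (∈-++⁻ l y∈)
  unique : Unique (∗ ∷ (upTo (suc n) ─ ∗))
  unique = ∉⇒∷-unique (λ ∗∈─ → proj₂ (∈-─⁻ {upTo (suc n)} ∗∈─) refl) id (─-unique ∗ (upTo⁺ (suc n)))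
  cover : ∀ {x} → x < suc n → x ∈ ∗ ∷ (upTo (suc n) ─ ∗)
  cover {x} x< with x ℕ.≟ ∗
  ... | yes x≡∗ = here x≡∗
  ... | no  x≢∗ = there (∈-─⁺ (∈-upTo⁺ x<) x≢∗)

catMaybes-map-just : ∀ {A : Set} (xs : List A) → catMaybes (map just xs) ≡ xs
catMaybes-map-just []       = refl
catMaybes-map-just (x ∷ xs) = cong (x ∷_) (catMaybes-map-just xs)

derangement-count : ∀ N → d 0 N ≡ avoiders N N
derangement-count N = begin
  d 0 N
    ≡⟨ length-filter≡countᵇ derangement? (perms N) ⟩
  countᵇ (does ∘ derangement?) (perms N)
    ≡⟨ countᵇ-perms N _ (avoidsBoard (map just (upTo N))) derangement≡ ⟩
  #arrangements (upTo N) (avoidsBoard (map just (upTo N)))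
    ≡⟨ #arrangements-avoidsBoard (upTo⁺ N) diagonal ⟩
  avoiders (length (upTo N)) (length (catMaybes (map just (upTo N))))
    ≡⟨ cong₂ avoiders (length-upTo N) (trans (cong length (catMaybes-map-just (upTo N))) (length-upTo N)) ⟩
  avoiders N N ∎
  where
  open ≡-Reasoning
  derangement≡ : ∀ p → does (derangement? p) ≡ avoidsBoard (map just (upTo N)) (values p)
  derangement≡ p = does-≡ (derangement? p)
    (λ der → avoidsBoard-values⁺ id p (λ i eq → der i (toℕ-injective eq)))
    (λ ok i eq → avoidsBoard-values⁻ id p ok i (cong toℕ eq))
  diagonal : IsBoard (upTo N) (map just (upTo N))
  diagonal = board (length-map just (upTo N))
                   (subst Unique (sym (catMaybes-map-just (upTo N))) (upTo⁺ N))
                   (subst (_⊆ upTo N) (sym (catMaybes-map-just (upTo N))) id)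

-- The marker N is no endpoint of an edge, so the cyclic condition is the linear one.
successionFree-count : ∀ m N → d (suc m) N ≡ avoiders N (N ∸ suc m)
successionFree-count m N = begin
  d (suc m) N
    ≡⟨ length-filter≡countᵇ (noSucc? (suc m)) (perms N) ⟩
  countᵇ (does ∘ noSucc? (suc m)) (perms N)
    ≡⟨ countᵇ-perms N _ (avoids (succession (suc m))) (noSucc≡ (suc m)) ⟩
  #arrangements (upTo N) (avoids (succession (suc m)))
    ≡⟨ #arrangements-cong (upTo N) linear ⟩
  #arrangements (upTo N) (avoidsAround N E)
    ≡⟨ #arrangements-avoidsAround (successions-pathSystem (s≤s z≤n) unique (there ∘ ∈-upTo⁺)) ⟩
  avoiders (length (upTo N)) (length E)
    ≡⟨ cong₂ avoiders (length-upTo N) (trans (length-map _ (upTo (N ∸ suc m))) (length-upTo (N ∸ suc m))) ⟩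
  avoiders N (N ∸ suc m) ∎
  where
  open ≡-Reasoning
  E : List (ℕ × ℕ)
  E = successions (suc m) N
  unique : Unique (N ∷ upTo N)
  unique = ¬Any⇒All¬ (upTo N) (λ N∈ → <-irrefl refl (∈-upTo⁻ N∈)) ∷ upTo⁺ N
  from : ∀ y → isEdge E N y ≡ false
  from y = isEdge-∉ E λ Ny∈ → <-irrefl refl (≤-<-trans (m≤m+n N (suc m)) (proj₁ (∈-successions⁻ Ny∈)))
  to : ∀ x → isEdge E x N ≡ false
  to x = isEdge-∉ E λ xN∈ → let x+k<N , N≡ = ∈-successions⁻ xN∈ in <-irrefl refl (subst (_< N) (sym N≡) x+k<N)
  linear : ∀ {l} → IsArrangement (upTo N) l → avoids (succession (suc m)) l ≡ avoidsAround N E l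
  linear {l} arr = sym (trans (avoids-ring (isEdge E) N l from to)
                              (avoids-successions l (∈-upTo⁻ ∘ IsArrangement.⊆S arr)))

corollary2p2 : (n k : ℕ) → 2 ≤ n → 1 ≤ k → k ≤ n ∸ 1 →
    (i : Fin n) → countFirst k n i ≡ d (k ∸ 1) (n ∸ 1)
corollary2p2 (suc n) (suc zero)    _ k≥1 _ i = trans (first-entry-count k≥1 i) (sym (derangement-count n))
corollary2p2 (suc n) (suc (suc m)) _ k≥1 _ i = trans (first-entry-count k≥1 i) (sym (successionFree-count m n))
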